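{- The $n\times n$ ASMs having at most one entry equal to $-1$ are exactly the $n\times n$ ASMs that classically avoid all of the words $111,1122,1212,1221,2112,2121,2211$ and whose transpose also classically avoids $111$. The number of such ASMs of size $n$ is $\frac{n!}{6}\binom{n}{3}+n!$.
   Context: An alternating sign matrix (ASM) is a square matrix with entries in $\{0,1,-1\}$ such that every row and every column sums to $1$ and the nonzero entries of each row and each column alternate in sign. A word $w=w_1\cdots w_m$ over positive integers with maximum letter $r$ is identified with the $m\times r$ $0$-$1$ matrix having a $1$ in position $(i,w_i)$ for each $i$ and $0$ elsewhere. A matrix $A$ with entries in $\{0,\pm1\}$ classically contains a $0$-$1$ matrix $B$ of size $m\times r$ if there are order-preserving injections $f:[m]\to$ (rows of $A$) and $g:[r]\to$ (columns of $A$) with $A_{f(i),g(j)}=1$ whenever $B_{i,j}=1$; otherwise $A$ classically avoids $B$. -}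

module Defs where

open import Data.Nat using (ℕ)
open import Data.Fin using (Fin; _<_)
open import Data.Integer using (ℤ; +_; -_; -1ℤ; 0ℤ; 1ℤ; _+_)
open import Data.Vec using (Vec; lookup; foldr′; tabulate; transpose; []; _∷_)
open import Data.Product using (_×_; Σ; ∃)
open import Data.Sum using (_⊎_)
open import Relation.Binary.PropositionalEquality using (_≡_; _≢_)
open import Relation.Nullary using (¬_)
open import Relation.Nullary.Decidable using (⌊_⌋)
open import Data.Fin using (_≟_)
open import Data.Bool using (if_then_else_)

Mat : ℕ → ℕ → Set
Mat m r = Vec (Vec ℤ r) m

_⟨_,_⟩ : ∀ {m r} → Mat m r → Fin m → Fin r → ℤ
A ⟨ i , j ⟩ = lookup (lookup A i) j

vsum : ∀ {k} → Vec ℤ k → ℤ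
vsum = foldr′ _+_ 0ℤ

Entries01 : ∀ {m r} → Mat m r → Set
Entries01 A = ∀ i j → (A ⟨ i , j ⟩ ≡ 0ℤ) ⊎ (A ⟨ i , j ⟩ ≡ 1ℤ) ⊎ (A ⟨ i , j ⟩ ≡ -1ℤ)

Alternates : ∀ {k} → Vec ℤ k → Set
Alternates {k} v = ∀ (j l : Fin k) → j < l →
  lookup v j ≢ 0ℤ → lookup v l ≢ 0ℤ →
  (∀ (t : Fin k) → j < t → t < l → lookup v t ≡ 0ℤ) →
  lookup v j ≡ - lookup v l

IsASM : ∀ {n} → Mat n n → Set
IsASM {n} A =
  Entries01 A ×
  (∀ (i : Fin n) → vsum (lookup A i) ≡ 1ℤ) ×
  (∀ (j : Fin n) → vsum (lookup (transpose A) j) ≡ 1ℤ) ×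
  (∀ (i : Fin n) → Alternates (lookup A i)) ×
  (∀ (j : Fin n) → Alternates (lookup (transpose A) j))

AtMostOneMinus : ∀ {m r} → Mat m r → Set
AtMostOneMinus A = ∀ i j i′ j′ → A ⟨ i , j ⟩ ≡ -1ℤ → A ⟨ i′ , j′ ⟩ ≡ -1ℤ →
  (i ≡ i′ × j ≡ j′)

StrictMono : ∀ {a b} → (Fin a → Fin b) → Set
StrictMono {a} f = ∀ (x y : Fin a) → x < y → f x < f y

Contains : ∀ {p q m r} → Mat p q → Mat m r → Set
Contains {p} {q} {m} {r} A B =
  Σ (Fin m → Fin p) λ f → Σ (Fin r → Fin q) λ g →
    StrictMono f × StrictMono g ×
    (∀ i j → B ⟨ i , j ⟩ ≡ 1ℤ → A ⟨ f i , g j ⟩ ≡ 1ℤ)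

Avoids : ∀ {p q m r} → Mat p q → Mat m r → Set
Avoids A B = ¬ Contains A B

-- the m × r 0-1 matrix of a word w = w₁⋯wₘ with letters in {1..r}
-- (letter k is represented by the element k-1 of Fin r): 1 at (i , wᵢ)
wordMat : ∀ {m r} → Vec (Fin r) m → Mat m r
wordMat w = tabulate λ i → tabulate λ j → if ⌊ lookup w i ≟ j ⌋ then 1ℤ else 0ℤ

open import Data.Fin using (zero; suc)

w111 : Vec (Fin 1) 3
w111 = zero ∷ zero ∷ zero ∷ []

private
  ₁ ₂ : Fin 2
  ₁ = zero
  ₂ = suc zero

w1122 w1212 w1221 w2112 w2121 w2211 : Vec (Fin 2) 4
w1122 = ₁ ∷ ₁ ∷ ₂ ∷ ₂ ∷ []
w1212 = ₁ ∷ ₂ ∷ ₁ ∷ ₂ ∷ []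
w1221 = ₁ ∷ ₂ ∷ ₂ ∷ ₁ ∷ []
w2112 = ₂ ∷ ₁ ∷ ₁ ∷ ₂ ∷ []
w2121 = ₂ ∷ ₁ ∷ ₂ ∷ ₁ ∷ []
w2211 = ₂ ∷ ₂ ∷ ₁ ∷ ₁ ∷ []

AvoidsAll : ∀ {n} → Mat n n → Set
AvoidsAll A =
  Avoids A (wordMat w111) ×
  Avoids A (wordMat w1122) × Avoids A (wordMat w1212) ×
  Avoids A (wordMat w1221) × Avoids A (wordMat w2112) ×
  Avoids A (wordMat w2121) × Avoids A (wordMat w2211) ×
  Avoids (transpose A) (wordMat w111)

module Submission where

-- Within a line of an ASM, two equal nonzero entries have an opposite one between them, and
-- every -1 has a 1 on each side. So if A has at most one -1, two 1s in a column force that -1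
-- between them: no column holds 111, no row holds 111, and no two columns hold a pair of 1s
-- each, which is what each of 1122, 1212, 1221, 2112, 2121, 2211 needs. Conversely, two -1s
-- in one column give 1, -1, 1, -1, 1 and hence 111. Two -1s in columns j < j′ have 1s above
-- and below them; if these four rows are distinct they spell one of the six two-letter words,
-- and otherwise a shared row carries a -1 strictly between columns j and j′, a closer pair.
-- For the count: an ASM without -1 is a permutation matrix (n! of them). One with a single -1
-- is the diamond (0 1 0 / 1 -1 1 / 0 1 0) on rows a < i < b and columns c < j < d, plus a
-- permutation matrix on the other n - 3 rows and columns: (n C 3)² (n - 3)! = (n!/6)(n C 3).

open import Defs
open import Data.Nat as ℕ using (ℕ; zero; suc; z≤n; s≤s; z<s; s<s; _+_; _*_; _∸_; _/_; _!)
import Data.Nat.Properties as ℕ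
open import Data.Nat.Combinatorics using (_C_; nCk+nC[k+1]≡[n+1]C[k+1]; nCn≡1; nCk≡n!/k![n-k]!; k![n∸k]!∣n!)
open import Data.Nat.DivMod using (m*n/n≡m)
open import Data.Nat.Divisibility using (divides)
open import Data.Fin as Fin using (Fin; zero; suc; _<_; _≤_; _<?_; punchIn; punchOut)
open import Data.Fin.Patterns using (0F; 1F; 2F; 3F)
import Data.Fin.Properties as Fin
open import Data.Fin.Induction using (<-wellFounded)
open import Data.Integer as ℤ using (ℤ; +_; -[1+_]; -_; -1ℤ; 0ℤ; 1ℤ)
import Data.Integer.Properties as ℤ
open import Data.Vec as V using (Vec; []; _∷_; lookup; tabulate; transpose; replicate; _⊛_; _[_]≔_)
import Data.Vec.Properties as Vec
open import Data.Vec.Relation.Unary.Linked using (Linked; [-]; _∷_)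
import Data.Vec.Relation.Unary.Linked.Properties as Linked
open import Data.List as List using (List; _++_; map; length; cartesianProduct; cartesianProductWith; allFin)
import Data.List.Properties as List
open import Data.List.Membership.Propositional using (_∈_)
import Data.List.Membership.Propositional.Properties as ∈
open import Data.List.Relation.Unary.Any using (here)
import Data.List.Relation.Unary.All as All
import Data.List.Relation.Unary.AllPairs as AllPairs
open import Data.List.Relation.Unary.Unique.Propositional using (Unique)
import Data.List.Relation.Unary.Unique.Propositional.Properties as Unique
open import Data.Product as Product using (_×_; Σ; ∃; ∃₂; _,_; proj₁; proj₂)
open import Data.Sum as Sum using (_⊎_; inj₁; inj₂)
open import Data.Empty using (⊥; ⊥-elim)
open import Data.Bool using (if_then_else_)
open import Function using (_∘_; flip)
open import Function.Definitions using (Injective)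
open import Algebra.Properties.CommutativeSemigroup ℤ.+-commutativeSemigroup using (x∙yz≈y∙xz)
open import Function.Bundles using (_⇔_; mk⇔; Equivalence)
open import Induction.WellFounded using (Acc; acc)
open import Relation.Binary using (tri<; tri≈; tri>)
open import Relation.Binary.PropositionalEquality
open import Relation.Nullary using (¬_; Dec; yes; no; ¬?)
open import Relation.Nullary.Decidable using (⌊_⌋; _×-dec_; decidable-stable)

lookup-ext : ∀ {a} {A : Set a} {k} {u v : Vec A k} → (∀ i → lookup u i ≡ lookup v i) → u ≡ v
lookup-ext {u = u} {v} u≗v =
  trans (sym (Vec.tabulate∘lookup u)) (trans (Vec.tabulate-cong u≗v) (Vec.tabulate∘lookup v))

entry-ext : ∀ {m r} {A B : Mat m r} → (∀ i j → A ⟨ i , j ⟩ ≡ B ⟨ i , j ⟩) → A ≡ B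
entry-ext A≗B = lookup-ext λ i → lookup-ext (A≗B i)

entry-tabulate : ∀ {m r} (f : Fin m → Fin r → ℤ) i j → (tabulate λ i → tabulate (f i)) ⟨ i , j ⟩ ≡ f i j
entry-tabulate f i j =
  trans (cong (λ row → lookup row j) (Vec.lookup∘tabulate (λ i → tabulate (f i)) i)) (Vec.lookup∘tabulate (f i) j)

lookup-transpose : ∀ {a} {A : Set a} {m r} (xss : Vec (Vec A r) m) i j →
                   lookup (lookup (transpose xss) j) i ≡ lookup (lookup xss i) j
lookup-transpose {r = r} (xs ∷ xss) i j = trans (cong (λ ys → lookup ys i) column-cons) (lookup-cons i)
  where
  open ≡-Reasoning
  column-cons : lookup (transpose (xs ∷ xss)) j ≡ lookup xs j ∷ lookup (transpose xss) j
  column-cons = begin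
    lookup (replicate r V._∷_ ⊛ xs ⊛ transpose xss) j
      ≡⟨ Vec.lookup-⊛ j (replicate r V._∷_ ⊛ xs) (transpose xss) ⟩
    lookup (replicate r V._∷_ ⊛ xs) j (lookup (transpose xss) j)
      ≡⟨ cong (λ f → f (lookup (transpose xss) j)) (Vec.lookup-⊛ j (replicate r V._∷_) xs) ⟩
    lookup (replicate r V._∷_) j (lookup xs j) (lookup (transpose xss) j)
      ≡⟨ cong (λ f → f (lookup xs j) (lookup (transpose xss) j)) (Vec.lookup-replicate j V._∷_) ⟩
    lookup xs j ∷ lookup (transpose xss) j ∎
  lookup-cons : ∀ i → lookup (lookup xs j ∷ lookup (transpose xss) j) i ≡ lookup (lookup (xs ∷ xss) i) j
  lookup-cons zero    = refl
  lookup-cons (suc i) = lookup-transpose xss i j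

neg-swap : ∀ {x y : ℤ} → x ≡ - y → y ≡ - x
neg-swap {x} {y} x≡-y = trans (sym (ℤ.neg-involutive y)) (cong -_ (sym x≡-y))

1ℤ≢0ℤ : 1ℤ ≢ 0ℤ
1ℤ≢0ℤ ()

-1ℤ≢0ℤ : -1ℤ ≢ 0ℤ
-1ℤ≢0ℤ ()

x≡-x⇒x≡0 : ∀ {x : ℤ} → x ≡ - x → x ≡ 0ℤ
x≡-x⇒x≡0 {+ zero}   _ = refl
x≡-x⇒x≡0 {+ suc _}  ()
x≡-x⇒x≡0 { -[1+ _ ]} ()

module _ {k : ℕ} where

  AllZero : Vec ℤ k → Set
  AllZero v = ∀ t → lookup v t ≡ 0ℤ

  IsFirstNonzero : Vec ℤ k → Fin k → Set
  IsFirstNonzero v f = lookup v f ≢ 0ℤ × (∀ t → t < f → lookup v t ≡ 0ℤ)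

  IsLastNonzero : Vec ℤ k → Fin k → Set
  IsLastNonzero v l = lookup v l ≢ 0ℤ × (∀ t → l < t → lookup v t ≡ 0ℤ)

  SignVector : Vec ℤ k → Set
  SignVector v = ∀ t → (lookup v t ≡ 0ℤ) ⊎ (lookup v t ≡ 1ℤ) ⊎ (lookup v t ≡ -1ℤ)

vsum-allZero : ∀ {k} (v : Vec ℤ k) → AllZero v → vsum v ≡ 0ℤ
vsum-allZero []      _      = refl
vsum-allZero (x ∷ v) v≡0 = cong₂ ℤ._+_ (v≡0 zero) (vsum-allZero v (v≡0 ∘ suc))

alternates-tail : ∀ {k} x (v : Vec ℤ k) → Alternates (x ∷ v) → Alternates v
alternates-tail x v alt j l j<l vj≢0 vl≢0 zero-between =
  alt (suc j) (suc l) (s≤s j<l) vj≢0 vl≢0 λ { zero () _ ; (suc t) (s≤s j<t) (s≤s t<l) → zero-between t j<t t<l }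

module _ {k} (v : Vec ℤ k) (alt : Alternates v) where

  -- Recurse on a nonzero entry strictly between p and r; if there is none, they are consecutive.
  opposite-after : ∀ {p r} → Acc _<_ r → p < r → lookup v p ≢ 0ℤ → lookup v r ≢ 0ℤ →
                   ∃ λ t → p < t × t ≤ r × lookup v t ≡ - lookup v p
  opposite-after {p} {r} (acc rs) p<r vp≢0 vr≢0
    with Fin.any? (λ t → (p <? t) ×-dec (t <? r) ×-dec ¬? (lookup v t ℤ.≟ 0ℤ))
  ... | yes (t , p<t , t<r , vt≢0) =
    let s , p<s , s≤t , vs≡-vp = opposite-after (rs t<r) p<t vp≢0 vt≢0
    in  s , p<s , Fin.≤-trans s≤t (ℕ.<⇒≤ t<r) , vs≡-vp
  ... | no no-nonzero-between = r , p<r , Fin.≤-refl , neg-swap (alt p r p<r vp≢0 vr≢0 zero-between)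
    where
    zero-between : ∀ t → p < t → t < r → lookup v t ≡ 0ℤ
    zero-between t p<t t<r =
      decidable-stable (lookup v t ℤ.≟ 0ℤ) λ vt≢0 → no-nonzero-between (t , p<t , t<r , vt≢0)

  opposite-between : ∀ {p r} → p < r → lookup v p ≢ 0ℤ → lookup v r ≡ lookup v p →
                     ∃ λ t → p < t × t < r × lookup v t ≡ - lookup v p
  opposite-between {p} {r} p<r vp≢0 vr≡vp
    with opposite-after (<-wellFounded r) p<r vp≢0 (vp≢0 ∘ trans (sym vr≡vp))
  ... | t , p<t , t≤r , vt≡-vp with t Fin.≟ r
  ... | no t≢r    = t , p<t , Fin.≤∧≢⇒< t≤r t≢r , vt≡-vp
  ... | yes refl = ⊥-elim (vp≢0 (x≡-x⇒x≡0 (trans (sym vr≡vp) vt≡-vp)))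

SumByEnds : ∀ {k} → Vec ℤ k → Fin k → Fin k → Set
SumByEnds v f l = (lookup v f ≡ lookup v l × vsum v ≡ lookup v f)
                ⊎ (lookup v f ≡ - lookup v l × vsum v ≡ 0ℤ)

EndsOf : ∀ {k} → Vec ℤ k → Set
EndsOf v = ∃₂ λ f l → IsFirstNonzero v f × IsLastNonzero v l × SumByEnds v f l

sumByEnds-0∷ : ∀ {k} (v : Vec ℤ k) {f l} → SumByEnds v f l → SumByEnds (0ℤ ∷ v) (suc f) (suc l)
sumByEnds-0∷ v (inj₁ (vf≡vl , sum≡vf)) = inj₁ (vf≡vl , trans (ℤ.+-identityˡ (vsum v)) sum≡vf)
sumByEnds-0∷ v (inj₂ (vf≡-vl , sum≡0)) = inj₂ (vf≡-vl , trans (ℤ.+-identityˡ (vsum v)) sum≡0)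

sumByEnds-x∷ : ∀ {k} x (v : Vec ℤ k) {f l} → x ≡ - lookup v f → SumByEnds v f l → SumByEnds (x ∷ v) zero (suc l)
sumByEnds-x∷ x v {f} x≡-vf (inj₁ (vf≡vl , sum≡vf)) =
  inj₂ (trans x≡-vf (cong -_ vf≡vl) , trans (cong₂ ℤ._+_ x≡-vf sum≡vf) (ℤ.+-inverseˡ (lookup v f)))
sumByEnds-x∷ x v x≡-vf (inj₂ (vf≡-vl , sum≡0)) =
  inj₁ (trans x≡-vf (sym (neg-swap vf≡-vl)) , trans (cong (ℤ._+_ x) sum≡0) (ℤ.+-identityʳ x))

alternating-ends : ∀ {k} (v : Vec ℤ k) → Alternates v → AllZero v ⊎ EndsOf v
alternating-ends []      _   = inj₁ λ ()
alternating-ends (x ∷ v) alt with alternating-ends v (alternates-tail x v alt) | x ℤ.≟ 0ℤ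
... | inj₁ v≡0 | yes refl = inj₁ λ { zero → refl ; (suc t) → v≡0 t }
... | inj₁ v≡0 | no x≢0  =
  inj₂ (zero , zero , (x≢0 , λ _ ()) , (x≢0 , λ { (suc t) _ → v≡0 t }) ,
        inj₁ (refl , trans (cong (ℤ._+_ x) (vsum-allZero v v≡0)) (ℤ.+-identityʳ x)))
... | inj₂ (f , l , (vf≢0 , before-f) , (vl≢0 , after-l) , ends) | yes refl =
  inj₂ (suc f , suc l , (vf≢0 , λ { zero _ → refl ; (suc t) (s≤s t<f) → before-f t t<f }) ,
        (vl≢0 , λ { (suc t) (s≤s l<t) → after-l t l<t }) , sumByEnds-0∷ v ends)
... | inj₂ (f , l , (vf≢0 , before-f) , (vl≢0 , after-l) , ends) | no x≢0 =
  inj₂ (zero , suc l , (x≢0 , λ _ ()) , (vl≢0 , λ { (suc t) (s≤s l<t) → after-l t l<t }) ,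
        sumByEnds-x∷ x v x≡-vf ends)
  where
  x≡-vf : x ≡ - lookup v f
  x≡-vf = alt zero (suc f) (s≤s z≤n) x≢0 vf≢0 λ { (suc t) _ (s≤s t<f) → before-f t t<f }

ends≡1 : ∀ {k} (v : Vec ℤ k) → Alternates v → vsum v ≡ 1ℤ →
         ∃₂ λ f l → IsFirstNonzero v f × IsLastNonzero v l × lookup v f ≡ 1ℤ × lookup v l ≡ 1ℤ
ends≡1 v alt sum≡1 with alternating-ends v alt
... | inj₁ v≡0 with trans (sym (vsum-allZero v v≡0)) sum≡1
...   | ()
ends≡1 v alt sum≡1 | inj₂ (f , l , first , last , inj₁ (vf≡vl , sum≡vf)) =
  f , l , first , last , trans (sym sum≡vf) sum≡1 , trans (sym vf≡vl) (trans (sym sum≡vf) sum≡1)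
ends≡1 v alt sum≡1 | inj₂ (f , l , first , last , inj₂ (_ , sum≡0)) with trans (sym sum≡0) sum≡1
...   | ()

module _ {k} (v : Vec ℤ k) (alt : Alternates v) where

  minus-between-ones : ∀ {s t} → s ≢ t → lookup v s ≡ 1ℤ → lookup v t ≡ 1ℤ →
                       ∃ λ u → (s < u × u < t ⊎ t < u × u < s) × lookup v u ≡ -1ℤ
  minus-between-ones {s} {t} s≢t vs≡1 vt≡1 with Fin.<-cmp s t
  ... | tri≈ _ s≡t _ = ⊥-elim (s≢t s≡t)
  ... | tri< s<t _ _ =
    let u , s<u , u<t , vu≡-vs = opposite-between v alt s<t (1ℤ≢0ℤ ∘ trans (sym vs≡1)) (trans vt≡1 (sym vs≡1))
    in  u , inj₁ (s<u , u<t) , trans vu≡-vs (cong -_ vs≡1)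
  ... | tri> _ _ t<s =
    let u , t<u , u<s , vu≡-vt = opposite-between v alt t<s (1ℤ≢0ℤ ∘ trans (sym vt≡1)) (trans vs≡1 (sym vt≡1))
    in  u , inj₂ (t<u , u<s) , trans vu≡-vt (cong -_ vt≡1)

  ones-around-minus : vsum v ≡ 1ℤ → ∀ {q} → lookup v q ≡ -1ℤ →
                      (∃ λ a → a < q × lookup v a ≡ 1ℤ) × (∃ λ b → q < b × lookup v b ≡ 1ℤ)
  ones-around-minus sum≡1 {q} vq≡-1 with ends≡1 v alt sum≡1
  ... | f , l , (_ , before-f) , (_ , after-l) , vf≡1 , vl≡1 = (f , f<q , vf≡1) , (l , q<l , vl≡1)
    where
    vq≢0 : lookup v q ≢ 0ℤ
    vq≢0 = -1ℤ≢0ℤ ∘ trans (sym vq≡-1)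
    f<q : f < q
    f<q with Fin.<-cmp f q
    ... | tri< f<q _ _ = f<q
    ... | tri≈ _ refl _ with trans (sym vf≡1) vq≡-1
    ...   | ()
    f<q | tri> _ _ q<f = ⊥-elim (vq≢0 (before-f q q<f))
    q<l : q < l
    q<l with Fin.<-cmp q l
    ... | tri< q<l _ _ = q<l
    ... | tri≈ _ refl _ with trans (sym vl≡1) vq≡-1
    ...   | ()
    q<l | tri> _ _ l<q = ⊥-elim (vq≢0 (after-l q l<q))

-- Lines are given by their entry functions, so that rows and columns of a matrix
-- are treated alike.
record IsUnitAt {k} (v : Fin k → ℤ) (p : Fin k) : Set where
  field
    one-at-p       : v p ≡ 1ℤ
    zero-elsewhere : ∀ t → t ≢ p → v t ≡ 0ℤ

record IsBumpAt {k} (v : Fin k → ℤ) (p q r : Fin k) : Set where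
  field
    p<q            : p < q
    q<r            : q < r
    one-at-p       : v p ≡ 1ℤ
    minus-at-q     : v q ≡ -1ℤ
    one-at-r       : v r ≡ 1ℤ
    zero-elsewhere : ∀ t → t ≢ p → t ≢ q → t ≢ r → v t ≡ 0ℤ

LineShape : ∀ {k} → (Fin k → ℤ) → Set
LineShape v = ∃ (IsUnitAt v) ⊎ ∃ λ p → ∃₂ (IsBumpAt v p)

module _ {k} {u v : Fin k → ℤ} (u≗v : ∀ t → u t ≡ v t) where

  unit-cong : ∀ {p} → IsUnitAt u p → IsUnitAt v p
  unit-cong unit = record
    { one-at-p       = trans (sym (u≗v _)) one-at-p
    ; zero-elsewhere = λ t t≢p → trans (sym (u≗v t)) (zero-elsewhere t t≢p) }
    where open IsUnitAt unit

  bump-cong : ∀ {p q r} → IsBumpAt u p q r → IsBumpAt v p q r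
  bump-cong bump = record
    { p<q = p<q ; q<r = q<r
    ; one-at-p       = trans (sym (u≗v _)) one-at-p
    ; minus-at-q     = trans (sym (u≗v _)) minus-at-q
    ; one-at-r       = trans (sym (u≗v _)) one-at-r
    ; zero-elsewhere = λ t t≢p t≢q t≢r → trans (sym (u≗v t)) (zero-elsewhere t t≢p t≢q t≢r) }
    where open IsBumpAt bump

  lineShape-cong : LineShape u → LineShape v
  lineShape-cong = Sum.map (Product.map₂ unit-cong) (Product.map₂ (Product.map₂ (Product.map₂ bump-cong)))

module _ {k} (v : Vec ℤ k) (alt : Alternates v) (sum≡1 : vsum v ≡ 1ℤ) (signs : SignVector v) where

  unit-shape : (∀ t → lookup v t ≢ -1ℤ) → ∃ (IsUnitAt (lookup v))
  unit-shape no-minus with ends≡1 v alt sum≡1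
  ... | f , _ , _ , _ , vf≡1 , _ = f , record { one-at-p = vf≡1 ; zero-elsewhere = zero-elsewhere }
    where
    zero-elsewhere : ∀ t → t ≢ f → lookup v t ≡ 0ℤ
    zero-elsewhere t t≢f with signs t
    ... | inj₁ vt≡0         = vt≡0
    ... | inj₂ (inj₂ vt≡-1) = ⊥-elim (no-minus t vt≡-1)
    ... | inj₂ (inj₁ vt≡1)  = ⊥-elim (no-minus _ (proj₂ (proj₂ (minus-between-ones v alt t≢f vt≡1 vf≡1))))

  bump-shape : ∀ {q} → lookup v q ≡ -1ℤ → (∀ t → lookup v t ≡ -1ℤ → t ≡ q) → ∃₂ λ p r → IsBumpAt (lookup v) p q r
  bump-shape {q} vq≡-1 minus-only-at-q with ones-around-minus v alt sum≡1 vq≡-1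
  ... | (p , p<q , vp≡1) , (r , q<r , vr≡1) = p , r , record
    { p<q = p<q ; q<r = q<r ; one-at-p = vp≡1 ; minus-at-q = vq≡-1 ; one-at-r = vr≡1
    ; zero-elsewhere = zero-elsewhere }
    where
    -- A further 1 at t would force a second -1 between t and p (if t < q) or t and r (if q < t).
    zero-elsewhere : ∀ t → t ≢ p → t ≢ q → t ≢ r → lookup v t ≡ 0ℤ
    zero-elsewhere t t≢p t≢q t≢r with signs t
    ... | inj₁ vt≡0         = vt≡0
    ... | inj₂ (inj₂ vt≡-1) = ⊥-elim (t≢q (minus-only-at-q t vt≡-1))
    ... | inj₂ (inj₁ vt≡1) with Fin.<-cmp t q
    ...   | tri≈ _ t≡q _ = ⊥-elim (t≢q t≡q)
    ...   | tri< t<q _ _ with minus-between-ones v alt t≢p vt≡1 vp≡1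
    ...     | u , inj₁ (_ , u<p) , vu≡-1 = ⊥-elim (Fin.<-irrefl (minus-only-at-q u vu≡-1) (Fin.<-trans u<p p<q))
    ...     | u , inj₂ (_ , u<t) , vu≡-1 = ⊥-elim (Fin.<-irrefl (minus-only-at-q u vu≡-1) (Fin.<-trans u<t t<q))
    zero-elsewhere t t≢p t≢q t≢r | inj₂ (inj₁ vt≡1) | tri> _ _ q<t with minus-between-ones v alt t≢r vt≡1 vr≡1
    ...     | u , inj₁ (t<u , _) , vu≡-1 = ⊥-elim (Fin.<-irrefl (sym (minus-only-at-q u vu≡-1)) (Fin.<-trans q<t t<u))
    ...     | u , inj₂ (r<u , _) , vu≡-1 = ⊥-elim (Fin.<-irrefl (sym (minus-only-at-q u vu≡-1)) (Fin.<-trans q<r r<u))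

vsum-update : ∀ {k} (v : Vec ℤ k) p → vsum v ≡ lookup v p ℤ.+ vsum (v [ p ]≔ 0ℤ)
vsum-update (x ∷ v) zero    = cong (ℤ._+_ x) (sym (ℤ.+-identityˡ (vsum v)))
vsum-update (x ∷ v) (suc p) = trans (cong (ℤ._+_ x) (vsum-update v p)) (x∙yz≈y∙xz x (lookup v p) _)

vsum-support : ∀ {k} (v : Vec ℤ k) p → (∀ t → t ≢ p → lookup v t ≡ 0ℤ) → vsum v ≡ lookup v p
vsum-support v p zero-elsewhere =
  trans (vsum-update v p) (trans (cong (ℤ._+_ (lookup v p)) (vsum-allZero (v [ p ]≔ 0ℤ) erased)) (ℤ.+-identityʳ _))
  where
  erased : AllZero (v [ p ]≔ 0ℤ)
  erased t with t Fin.≟ p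
  ... | yes refl = Vec.lookup∘update p v 0ℤ
  ... | no t≢p  = trans (Vec.lookup∘update′ t≢p v 0ℤ) (zero-elsewhere t t≢p)

module _ {k} (v : Vec ℤ k) where

  unit-sum : ∀ {p} → IsUnitAt (lookup v) p → vsum v ≡ 1ℤ
  unit-sum {p} unit = trans (vsum-support v p zero-elsewhere) one-at-p
    where open IsUnitAt unit

  bump-sum : ∀ {p q r} → IsBumpAt (lookup v) p q r → vsum v ≡ 1ℤ
  bump-sum {p} {q} {r} bump = begin
    vsum v                                  ≡⟨ vsum-update v p ⟩
    lookup v p ℤ.+ vsum v₁                  ≡⟨ cong (ℤ._+_ (lookup v p)) (vsum-update v₁ q) ⟩
    lookup v p ℤ.+ (lookup v₁ q ℤ.+ vsum v₂) ≡⟨ cong₂ (λ x y → lookup v p ℤ.+ (x ℤ.+ y)) v₁q≡vq (vsum-support v₂ r v₂-support) ⟩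
    lookup v p ℤ.+ (lookup v q ℤ.+ lookup v₂ r) ≡⟨ cong₂ (λ x y → x ℤ.+ (lookup v q ℤ.+ y)) one-at-p v₂r≡vr ⟩
    1ℤ ℤ.+ (lookup v q ℤ.+ lookup v r)       ≡⟨ cong₂ (λ x y → 1ℤ ℤ.+ (x ℤ.+ y)) minus-at-q one-at-r ⟩
    1ℤ ∎
    where
    open IsBumpAt bump
    open ≡-Reasoning
    v₁ v₂ : Vec ℤ k
    v₁ = v [ p ]≔ 0ℤ
    v₂ = v₁ [ q ]≔ 0ℤ
    q≢p : q ≢ p
    q≢p = Fin.<⇒≢ p<q ∘ sym
    r≢p : r ≢ p
    r≢p = Fin.<⇒≢ (Fin.<-trans p<q q<r) ∘ sym
    r≢q : r ≢ q
    r≢q = Fin.<⇒≢ q<r ∘ sym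
    v₁q≡vq : lookup v₁ q ≡ lookup v q
    v₁q≡vq = Vec.lookup∘update′ q≢p v 0ℤ
    v₂r≡vr : lookup v₂ r ≡ lookup v r
    v₂r≡vr = trans (Vec.lookup∘update′ r≢q v₁ 0ℤ) (Vec.lookup∘update′ r≢p v 0ℤ)
    v₂-support : ∀ t → t ≢ r → lookup v₂ t ≡ 0ℤ
    v₂-support t t≢r with t Fin.≟ q | t Fin.≟ p
    ... | yes refl | _ = Vec.lookup∘update q v₁ 0ℤ
    ... | no t≢q | yes refl = trans (Vec.lookup∘update′ t≢q v₁ 0ℤ) (Vec.lookup∘update p v 0ℤ)
    ... | no t≢q | no t≢p =
      trans (Vec.lookup∘update′ t≢q v₁ 0ℤ) (trans (Vec.lookup∘update′ t≢p v 0ℤ) (zero-elsewhere t t≢p t≢q t≢r))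

  unit-alternates : ∀ {p} → IsUnitAt (lookup v) p → Alternates v
  unit-alternates {p} unit j l j<l vj≢0 vl≢0 _ = ⊥-elim (Fin.<-irrefl (trans (at-p j vj≢0) (sym (at-p l vl≢0))) j<l)
    where
    open IsUnitAt unit
    at-p : ∀ t → lookup v t ≢ 0ℤ → t ≡ p
    at-p t vt≢0 = decidable-stable (t Fin.≟ p) (vt≢0 ∘ zero-elsewhere t)

  bump-alternates : ∀ {p q r} → IsBumpAt (lookup v) p q r → Alternates v
  bump-alternates {p} {q} {r} bump j l j<l vj≢0 vl≢0 zero-between = consecutive (at-pqr j vj≢0) (at-pqr l vl≢0)
    where
    open IsBumpAt bump
    at-pqr : ∀ t → lookup v t ≢ 0ℤ → t ≡ p ⊎ t ≡ q ⊎ t ≡ r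
    at-pqr t vt≢0 with t Fin.≟ p | t Fin.≟ q | t Fin.≟ r
    ... | yes t≡p | _       | _       = inj₁ t≡p
    ... | _       | yes t≡q | _       = inj₂ (inj₁ t≡q)
    ... | _       | _       | yes t≡r = inj₂ (inj₂ t≡r)
    ... | no t≢p  | no t≢q  | no t≢r  = ⊥-elim (vt≢0 (zero-elsewhere t t≢p t≢q t≢r))
    consecutive : j ≡ p ⊎ j ≡ q ⊎ j ≡ r → l ≡ p ⊎ l ≡ q ⊎ l ≡ r → lookup v j ≡ - lookup v l
    consecutive (inj₁ refl)        (inj₂ (inj₁ refl)) = trans one-at-p (cong -_ (sym minus-at-q))
    consecutive (inj₂ (inj₁ refl)) (inj₂ (inj₂ refl)) = trans minus-at-q (cong -_ (sym one-at-r))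
    consecutive (inj₁ refl)        (inj₂ (inj₂ refl)) = ⊥-elim (-1ℤ≢0ℤ (trans (sym minus-at-q) (zero-between q p<q q<r)))
    consecutive (inj₁ refl)        (inj₁ refl)        = ⊥-elim (Fin.<-irrefl refl j<l)
    consecutive (inj₂ (inj₁ refl)) (inj₂ (inj₁ refl)) = ⊥-elim (Fin.<-irrefl refl j<l)
    consecutive (inj₂ (inj₂ refl)) (inj₂ (inj₂ refl)) = ⊥-elim (Fin.<-irrefl refl j<l)
    consecutive (inj₂ (inj₁ refl)) (inj₁ refl)        = ⊥-elim (Fin.<-asym j<l p<q)
    consecutive (inj₂ (inj₂ refl)) (inj₁ refl)        = ⊥-elim (Fin.<-asym j<l (Fin.<-trans p<q q<r))
    consecutive (inj₂ (inj₂ refl)) (inj₂ (inj₁ refl)) = ⊥-elim (Fin.<-asym j<l q<r)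

lineShape-sum : ∀ {k} (v : Vec ℤ k) → LineShape (lookup v) → vsum v ≡ 1ℤ
lineShape-sum v (inj₁ (_ , unit))         = unit-sum v unit
lineShape-sum v (inj₂ (_ , _ , _ , bump)) = bump-sum v bump

lineShape-alternates : ∀ {k} (v : Vec ℤ k) → LineShape (lookup v) → Alternates v
lineShape-alternates v (inj₁ (_ , unit))         = unit-alternates v unit
lineShape-alternates v (inj₂ (_ , _ , _ , bump)) = bump-alternates v bump

unit-position : ∀ {k} {v : Fin k → ℤ} {p t} → IsUnitAt v p → v t ≡ 1ℤ → t ≡ p
unit-position {p = p} {t} unit vt≡1 =
  decidable-stable (t Fin.≟ p) λ t≢p → 1ℤ≢0ℤ (trans (sym vt≡1) (IsUnitAt.zero-elsewhere unit t t≢p))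

unit-zero-elsewhere : ∀ {k} {v : Fin k → ℤ} {p t} → IsUnitAt v p → v t ≡ 1ℤ → ∀ t′ → t′ ≢ t → v t′ ≡ 0ℤ
unit-zero-elsewhere unit vt≡1 t′ t′≢t =
  IsUnitAt.zero-elsewhere unit t′ (t′≢t ∘ flip trans (sym (unit-position unit vt≡1)))

ordered-pair-unique : ∀ {k} {a b a′ b′ : Fin k} → a < b → a′ < b′ →
                      a′ ≡ a ⊎ a′ ≡ b → b′ ≡ a ⊎ b′ ≡ b → a′ ≡ a × b′ ≡ b
ordered-pair-unique a<b a′<b′ (inj₁ refl) (inj₂ refl) = refl , refl
ordered-pair-unique a<b a′<b′ (inj₁ refl) (inj₁ refl) = ⊥-elim (Fin.<-irrefl refl a′<b′)
ordered-pair-unique a<b a′<b′ (inj₂ refl) (inj₂ refl) = ⊥-elim (Fin.<-irrefl refl a′<b′)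
ordered-pair-unique a<b a′<b′ (inj₂ refl) (inj₁ refl) = ⊥-elim (Fin.<-asym a<b a′<b′)

bump-ends-unique : ∀ {k} {v : Fin k → ℤ} {p q r p′ q′ r′} → IsBumpAt v p q r → IsBumpAt v p′ q′ r′ → p′ ≡ p × r′ ≡ r
bump-ends-unique {v = v} {p} {q} {r} bump bump′ =
  ordered-pair-unique (Fin.<-trans p<q q<r) (Fin.<-trans (IsBumpAt.p<q bump′) (IsBumpAt.q<r bump′))
    (one-at-end (IsBumpAt.one-at-p bump′)) (one-at-end (IsBumpAt.one-at-r bump′))
  where
  open IsBumpAt bump
  one-at-end : ∀ {t} → v t ≡ 1ℤ → t ≡ p ⊎ t ≡ r
  one-at-end {t} vt≡1 with t Fin.≟ p | t Fin.≟ r | t Fin.≟ q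
  ... | yes t≡p | _       | _        = inj₁ t≡p
  ... | _       | yes t≡r | _        = inj₂ t≡r
  ... | no _    | no _    | yes refl with trans (sym vt≡1) minus-at-q
  ...   | ()
  one-at-end vt≡1 | no t≢p | no t≢r | no t≢q = ⊥-elim (1ℤ≢0ℤ (trans (sym vt≡1) (zero-elsewhere _ t≢p t≢q t≢r)))

column : ∀ {m r} → Mat m r → Fin r → Fin m → ℤ
column A j i = A ⟨ i , j ⟩

lookup-column : ∀ {m r} (A : Mat m r) j i → lookup (lookup (transpose A) j) i ≡ column A j i
lookup-column A j i = lookup-transpose A i j

asm-from-shapes : ∀ {n} (A : Mat n n) → Entries01 A →
                  (∀ i → LineShape (lookup (lookup A i))) → (∀ j → LineShape (column A j)) → IsASM A
asm-from-shapes A signs row-shape column-shape =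
  signs ,
  (λ i → lineShape-sum (lookup A i) (row-shape i)) ,
  (λ j → lineShape-sum (lookup (transpose A) j) (column-vector-shape j)) ,
  (λ i → lineShape-alternates (lookup A i) (row-shape i)) ,
  (λ j → lineShape-alternates (lookup (transpose A) j) (column-vector-shape j))
  where
  column-vector-shape : ∀ j → LineShape (lookup (lookup (transpose A) j))
  column-vector-shape j = lineShape-cong (λ i → sym (lookup-column A j i)) (column-shape j)

module ASM {n} (A : Mat n n) (asm : IsASM A) where

  private
    signs : Entries01 A
    signs = proj₁ asm
    row-sum : ∀ i → vsum (lookup A i) ≡ 1ℤ
    row-sum = proj₁ (proj₂ asm)
    column-sum : ∀ j → vsum (lookup (transpose A) j) ≡ 1ℤ
    column-sum = proj₁ (proj₂ (proj₂ asm))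
    row-alternates : ∀ i → Alternates (lookup A i)
    row-alternates = proj₁ (proj₂ (proj₂ (proj₂ asm)))
    column-alternates : ∀ j → Alternates (lookup (transpose A) j)
    column-alternates = proj₂ (proj₂ (proj₂ (proj₂ asm)))
    column-signs : ∀ j → SignVector (lookup (transpose A) j)
    column-signs j t rewrite lookup-column A j t = signs t j

  opposite-between-in-row : ∀ {i x y c} → c ≢ 0ℤ → A ⟨ i , x ⟩ ≡ c → A ⟨ i , y ⟩ ≡ c → x < y →
                            ∃ λ t → x < t × t < y × A ⟨ i , t ⟩ ≡ - c
  opposite-between-in-row {i} c≢0 Aix≡c Aiy≡c x<y
    with opposite-between (lookup A i) (row-alternates i) x<y (c≢0 ∘ trans (sym Aix≡c)) (trans Aiy≡c (sym Aix≡c))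
  ... | t , x<t , t<y , Ait≡-Aix = t , x<t , t<y , trans Ait≡-Aix (cong -_ Aix≡c)

  opposite-between-in-column : ∀ {j x y c} → c ≢ 0ℤ → A ⟨ x , j ⟩ ≡ c → A ⟨ y , j ⟩ ≡ c → x < y →
                               ∃ λ t → x < t × t < y × A ⟨ t , j ⟩ ≡ - c
  opposite-between-in-column {j} {x} {y} c≢0 Axj≡c Ayj≡c x<y
    with opposite-between (lookup (transpose A) j) (column-alternates j) x<y
           (c≢0 ∘ trans (sym (trans (lookup-column A j x) Axj≡c)))
           (trans (lookup-column A j y) (trans Ayj≡c (sym (trans (lookup-column A j x) Axj≡c))))
  ... | t , x<t , t<y , e = t , x<t , t<y , trans (sym (lookup-column A j t)) (trans e (cong -_ (trans (lookup-column A j x) Axj≡c)))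

  ones-around-minus-in-column : ∀ {q j} → A ⟨ q , j ⟩ ≡ -1ℤ →
                                (∃ λ a → a < q × A ⟨ a , j ⟩ ≡ 1ℤ) × (∃ λ b → q < b × A ⟨ b , j ⟩ ≡ 1ℤ)
  ones-around-minus-in-column {q} {j} Aqj≡-1
    with ones-around-minus (lookup (transpose A) j) (column-alternates j) (column-sum j) (trans (lookup-column A j q) Aqj≡-1)
  ... | (a , a<q , a-one) , (b , q<b , b-one) =
    (a , a<q , trans (sym (lookup-column A j a)) a-one) , (b , q<b , trans (sym (lookup-column A j b)) b-one)

  unit-row : ∀ i → (∀ t → A ⟨ i , t ⟩ ≢ -1ℤ) → ∃ (IsUnitAt (lookup (lookup A i)))
  unit-row i = unit-shape (lookup A i) (row-alternates i) (row-sum i) (signs i)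

  unit-column : ∀ j → (∀ t → A ⟨ t , j ⟩ ≢ -1ℤ) → ∃ (IsUnitAt (column A j))
  unit-column j no-minus =
    Product.map₂ (unit-cong (lookup-column A j))
      (unit-shape (lookup (transpose A) j) (column-alternates j) (column-sum j) (column-signs j)
        λ t → no-minus t ∘ trans (sym (lookup-column A j t)))

  bump-row : ∀ {i q} → A ⟨ i , q ⟩ ≡ -1ℤ → (∀ t → A ⟨ i , t ⟩ ≡ -1ℤ → t ≡ q) →
             ∃₂ λ p r → IsBumpAt (lookup (lookup A i)) p q r
  bump-row {i} = bump-shape (lookup A i) (row-alternates i) (row-sum i) (signs i)

  bump-column : ∀ {q j} → A ⟨ q , j ⟩ ≡ -1ℤ → (∀ t → A ⟨ t , j ⟩ ≡ -1ℤ → t ≡ q) →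
                ∃₂ λ p r → IsBumpAt (column A j) p q r
  bump-column {q} {j} Aqj≡-1 minus-only-at-q =
    Product.map₂ (Product.map₂ (bump-cong (lookup-column A j)))
      (bump-shape (lookup (transpose A) j) (column-alternates j) (column-sum j) (column-signs j)
        (trans (lookup-column A j q) Aqj≡-1) λ t → minus-only-at-q t ∘ trans (sym (lookup-column A j t)))

lookup-strictMono : ∀ {m n} {xs : Vec (Fin n) m} → Linked _<_ xs → StrictMono (lookup xs)
lookup-strictMono linked _ _ = Linked.lookup⁺ Fin.<-trans linked

indicator : ∀ {k} → Fin k → Fin k → ℤ
indicator a j = if ⌊ a Fin.≟ j ⌋ then 1ℤ else 0ℤ

indicator-same : ∀ {k} (a : Fin k) → indicator a a ≡ 1ℤ
indicator-same a with a Fin.≟ a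
... | yes _   = refl
... | no a≢a = ⊥-elim (a≢a refl)

indicator-other : ∀ {k} {a j : Fin k} → a ≢ j → indicator a j ≡ 0ℤ
indicator-other {a = a} {j} a≢j with a Fin.≟ j
... | yes a≡j = ⊥-elim (a≢j a≡j)
... | no _    = refl

indicator≡1 : ∀ {k} {a j : Fin k} → indicator a j ≡ 1ℤ → a ≡ j
indicator≡1 {a = a} {j} ind≡1 = decidable-stable (a Fin.≟ j) λ a≢j → 1ℤ≢0ℤ (trans (sym ind≡1) (indicator-other a≢j))

indicator-signs : ∀ {k} (a j : Fin k) → indicator a j ≡ 0ℤ ⊎ indicator a j ≡ 1ℤ ⊎ indicator a j ≡ -1ℤ
indicator-signs a j with a Fin.≟ j
... | yes _ = inj₂ (inj₁ refl)
... | no _  = inj₁ refl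

indicator≢-1 : ∀ {k} (a j : Fin k) → indicator a j ≢ -1ℤ
indicator≢-1 a j with a Fin.≟ j
... | yes _ = λ ()
... | no _  = λ ()

wordMat-entry : ∀ {m r} (w : Vec (Fin r) m) i j → wordMat w ⟨ i , j ⟩ ≡ indicator (lookup w i) j
wordMat-entry w = entry-tabulate (λ i → indicator (lookup w i))

ContainsWord : ∀ {p q m r} → Mat p q → Vec (Fin r) m → Set
ContainsWord {p} {q} {m} {r} A w =
  Σ (Fin m → Fin p) λ f → Σ (Fin r → Fin q) λ g →
    StrictMono f × StrictMono g × (∀ i → A ⟨ f i , g (lookup w i) ⟩ ≡ 1ℤ)

contains-word : ∀ {p q m r} (A : Mat p q) (w : Vec (Fin r) m) → Contains A (wordMat w) ⇔ ContainsWord A w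
contains-word A w = mk⇔
  (λ (f , g , f-mono , g-mono , ones) →
     f , g , f-mono , g-mono , λ i → ones i (lookup w i) (trans (wordMat-entry w i _) (indicator-same _)))
  (λ (f , g , f-mono , g-mono , ones) →
     f , g , f-mono , g-mono , λ i j w≡1 →
       subst (λ l → A ⟨ f i , g l ⟩ ≡ 1ℤ) (indicator≡1 (trans (sym (wordMat-entry w i j)) w≡1)) (ones i))

module _ {n} (A : Mat n n) (asm : IsASM A) (at-most-one : AtMostOneMinus A) where
  open ASM A asm

  column-avoids-111 : Avoids A (wordMat w111)
  column-avoids-111 contains
    with Equivalence.to (contains-word A w111) contains
  ... | f , g , f-mono , _ , ones
    with opposite-between-in-column 1ℤ≢0ℤ (ones 0F) (ones 1F) (f-mono 0F 1F z<s)
       | opposite-between-in-column 1ℤ≢0ℤ (ones 1F) (ones 2F) (f-mono 1F 2F (s<s z<s))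
  ... | t , _ , t<f₁ , At≡-1 | t′ , f₁<t′ , _ , At′≡-1 =
    Fin.<-irrefl (proj₁ (at-most-one t _ t′ _ At≡-1 At′≡-1)) (Fin.<-trans t<f₁ f₁<t′)

  row-avoids-111 : Avoids (transpose A) (wordMat w111)
  row-avoids-111 contains
    with Equivalence.to (contains-word (transpose A) w111) contains
  ... | f , g , f-mono , _ , ones
    with opposite-between-in-row 1ℤ≢0ℤ (in-row (ones 0F)) (in-row (ones 1F)) (f-mono 0F 1F z<s)
       | opposite-between-in-row 1ℤ≢0ℤ (in-row (ones 1F)) (in-row (ones 2F)) (f-mono 1F 2F (s<s z<s))
    where
    in-row : ∀ {i j} → transpose A ⟨ j , i ⟩ ≡ 1ℤ → A ⟨ i , j ⟩ ≡ 1ℤ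
    in-row = trans (sym (lookup-transpose A _ _))
  ... | t , _ , t<f₁ , At≡-1 | t′ , f₁<t′ , _ , At′≡-1 =
    Fin.<-irrefl (proj₂ (at-most-one _ t _ t′ At≡-1 At′≡-1)) (Fin.<-trans t<f₁ f₁<t′)

  pairs-of-ones-in-two-columns : ∀ {x y x′ y′ c c′} → c < c′ → x < y → x′ < y′ →
    A ⟨ x , c ⟩ ≡ 1ℤ → A ⟨ y , c ⟩ ≡ 1ℤ → A ⟨ x′ , c′ ⟩ ≡ 1ℤ → A ⟨ y′ , c′ ⟩ ≡ 1ℤ → ⊥
  pairs-of-ones-in-two-columns c<c′ x<y x′<y′ Axc Ayc Ax′c′ Ay′c′
    with opposite-between-in-column 1ℤ≢0ℤ Axc Ayc x<y | opposite-between-in-column 1ℤ≢0ℤ Ax′c′ Ay′c′ x′<y′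
  ... | t , _ , _ , At≡-1 | t′ , _ , _ , At′≡-1 = Fin.<-irrefl (proj₂ (at-most-one t _ t′ _ At≡-1 At′≡-1)) c<c′

  two-letter-word-avoided : ∀ (w : Vec (Fin 2) 4) {p q p′ q′} → p < q → p′ < q′ →
    lookup w p ≡ 0F → lookup w q ≡ 0F → lookup w p′ ≡ 1F → lookup w q′ ≡ 1F → Avoids A (wordMat w)
  two-letter-word-avoided w p<q p′<q′ wp wq wp′ wq′ contains
    with Equivalence.to (contains-word A w) contains
  ... | f , g , f-mono , g-mono , ones =
    pairs-of-ones-in-two-columns (g-mono 0F 1F z<s) (f-mono _ _ p<q) (f-mono _ _ p′<q′)
      (letter wp) (letter wq) (letter wp′) (letter wq′)
    where
    letter : ∀ {i l} → lookup w i ≡ l → A ⟨ f i , g l ⟩ ≡ 1ℤ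
    letter {i} wi≡l = subst (λ l → A ⟨ f i , g l ⟩ ≡ 1ℤ) wi≡l (ones i)

  atMostOneMinus⇒avoidsAll : AvoidsAll A
  atMostOneMinus⇒avoidsAll =
    column-avoids-111 ,
    two-letter-word-avoided w1122 {0F} {1F} {2F} {3F} z<s (s<s (s<s z<s)) refl refl refl refl ,
    two-letter-word-avoided w1212 {0F} {2F} {1F} {3F} z<s (s<s z<s) refl refl refl refl ,
    two-letter-word-avoided w1221 {0F} {3F} {1F} {2F} z<s (s<s z<s) refl refl refl refl ,
    two-letter-word-avoided w2112 {1F} {2F} {0F} {3F} (s<s z<s) z<s refl refl refl refl ,
    two-letter-word-avoided w2121 {1F} {3F} {0F} {2F} (s<s z<s) z<s refl refl refl refl ,
    two-letter-word-avoided w2211 {2F} {3F} {0F} {1F} (s<s (s<s z<s)) z<s refl refl refl refl ,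
    row-avoids-111

module _ {n} (A : Mat n n) (asm : IsASM A) (avoids : AvoidsAll A) where
  open ASM A asm

  private
    avoids-111  : Avoids A (wordMat w111)
    avoids-1122 : Avoids A (wordMat w1122)
    avoids-1212 : Avoids A (wordMat w1212)
    avoids-1221 : Avoids A (wordMat w1221)
    avoids-2112 : Avoids A (wordMat w2112)
    avoids-2121 : Avoids A (wordMat w2121)
    avoids-2211 : Avoids A (wordMat w2211)
    avoids-111  = proj₁ avoids
    avoids-1122 = proj₁ (proj₂ avoids)
    avoids-1212 = proj₁ (proj₂ (proj₂ avoids))
    avoids-1221 = proj₁ (proj₂ (proj₂ (proj₂ avoids)))
    avoids-2112 = proj₁ (proj₂ (proj₂ (proj₂ (proj₂ avoids))))
    avoids-2121 = proj₁ (proj₂ (proj₂ (proj₂ (proj₂ (proj₂ avoids)))))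
    avoids-2211 = proj₁ (proj₂ (proj₂ (proj₂ (proj₂ (proj₂ (proj₂ avoids))))))

  no-two-minuses-in-a-column : ∀ {i i′ j} → A ⟨ i , j ⟩ ≡ -1ℤ → A ⟨ i′ , j ⟩ ≡ -1ℤ → i < i′ → ⊥
  no-two-minuses-in-a-column {i} {i′} {j} Aij≡-1 Ai′j≡-1 i<i′
    with ones-around-minus-in-column Aij≡-1 | ones-around-minus-in-column Ai′j≡-1
       | opposite-between-in-column -1ℤ≢0ℤ Aij≡-1 Ai′j≡-1 i<i′
  ... | (a , a<i , Aaj≡1) , _ | _ , (b , i′<b , Abj≡1) | t , i<t , t<i′ , Atj≡1 =
    avoids-111 (Equivalence.from (contains-word A w111)
      ( lookup (a ∷ t ∷ b ∷ [])
      , (λ _ → j)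
      , lookup-strictMono (Fin.<-trans a<i i<t ∷ Fin.<-trans t<i′ i′<b ∷ [-])
      , (λ { 0F 0F () })
      , λ { 0F → Aaj≡1 ; 1F → Atj≡1 ; 2F → Abj≡1 }))

  module _ {j j′ : Fin n} (j<j′ : j < j′) {a b c d : Fin n}
           (Aaj≡1 : A ⟨ a , j ⟩ ≡ 1ℤ) (Abj≡1 : A ⟨ b , j ⟩ ≡ 1ℤ)
           (Acj′≡1 : A ⟨ c , j′ ⟩ ≡ 1ℤ) (Adj′≡1 : A ⟨ d , j′ ⟩ ≡ 1ℤ) where

    private
      occurrence : ∀ (w : Vec (Fin 2) 4) (rows : Vec (Fin n) 4) → Linked _<_ rows →
                   (∀ i → A ⟨ lookup rows i , lookup (j ∷ j′ ∷ []) (lookup w i) ⟩ ≡ 1ℤ) →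
                   Contains A (wordMat w)
      occurrence w rows sorted ones = Equivalence.from (contains-word A w)
        (lookup rows , lookup (j ∷ j′ ∷ []) , lookup-strictMono sorted , lookup-strictMono (j<j′ ∷ [-]) , ones)

    disjoint-pairs-of-ones-in-two-columns : a < b → c < d → a ≢ c → a ≢ d → b ≢ c → b ≢ d → ⊥
    disjoint-pairs-of-ones-in-two-columns a<b c<d a≢c a≢d b≢c b≢d with Fin.<-cmp a c
    ... | tri≈ _ a≡c _ = a≢c a≡c
    ... | tri< a<c _ _ with Fin.<-cmp b c
    ...   | tri≈ _ b≡c _ = b≢c b≡c
    ...   | tri< b<c _ _ = avoids-1122 (occurrence w1122 (a ∷ b ∷ c ∷ d ∷ []) (a<b ∷ b<c ∷ c<d ∷ [-])
                             λ { 0F → Aaj≡1 ; 1F → Abj≡1 ; 2F → Acj′≡1 ; 3F → Adj′≡1 })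
    ...   | tri> _ _ c<b with Fin.<-cmp b d
    ...     | tri≈ _ b≡d _ = b≢d b≡d
    ...     | tri< b<d _ _ = avoids-1212 (occurrence w1212 (a ∷ c ∷ b ∷ d ∷ []) (a<c ∷ c<b ∷ b<d ∷ [-])
                               λ { 0F → Aaj≡1 ; 1F → Acj′≡1 ; 2F → Abj≡1 ; 3F → Adj′≡1 })
    ...     | tri> _ _ d<b = avoids-1221 (occurrence w1221 (a ∷ c ∷ d ∷ b ∷ []) (a<c ∷ c<d ∷ d<b ∷ [-])
                               λ { 0F → Aaj≡1 ; 1F → Acj′≡1 ; 2F → Adj′≡1 ; 3F → Abj≡1 })
    disjoint-pairs-of-ones-in-two-columns a<b c<d a≢c a≢d b≢c b≢d | tri> _ _ c<a with Fin.<-cmp a d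
    ...   | tri≈ _ a≡d _ = a≢d a≡d
    ...   | tri> _ _ d<a = avoids-2211 (occurrence w2211 (c ∷ d ∷ a ∷ b ∷ []) (c<d ∷ d<a ∷ a<b ∷ [-])
                             λ { 0F → Acj′≡1 ; 1F → Adj′≡1 ; 2F → Aaj≡1 ; 3F → Abj≡1 })
    ...   | tri< a<d _ _ with Fin.<-cmp b d
    ...     | tri≈ _ b≡d _ = b≢d b≡d
    ...     | tri< b<d _ _ = avoids-2112 (occurrence w2112 (c ∷ a ∷ b ∷ d ∷ []) (c<a ∷ a<b ∷ b<d ∷ [-])
                               λ { 0F → Acj′≡1 ; 1F → Aaj≡1 ; 2F → Abj≡1 ; 3F → Adj′≡1 })
    ...     | tri> _ _ d<b = avoids-2121 (occurrence w2121 (c ∷ a ∷ d ∷ b ∷ []) (c<a ∷ a<d ∷ d<b ∷ [-])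
                               λ { 0F → Acj′≡1 ; 1F → Aaj≡1 ; 2F → Adj′≡1 ; 3F → Abj≡1 })

  no-minuses-in-distinct-columns : ∀ {i i′ j j′} → Acc _<_ j′ → j < j′ → A ⟨ i , j ⟩ ≡ -1ℤ → A ⟨ i′ , j′ ⟩ ≡ -1ℤ → ⊥
  no-minuses-in-distinct-columns {i} {i′} {j} {j′} (acc rs) j<j′ Aij≡-1 Ai′j′≡-1
    with ones-around-minus-in-column Aij≡-1 | ones-around-minus-in-column Ai′j′≡-1
  ... | (a , a<i , Aaj≡1) , (b , i<b , Abj≡1) | (c , c<i′ , Acj′≡1) , (d , i′<d , Adj′≡1) =
    separate (a Fin.≟ c) (a Fin.≟ d) (b Fin.≟ c) (b Fin.≟ d)
    where
    shared-row : ∀ {x} → A ⟨ x , j ⟩ ≡ 1ℤ → A ⟨ x , j′ ⟩ ≡ 1ℤ → ⊥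
    shared-row Axj≡1 Axj′≡1 with opposite-between-in-row 1ℤ≢0ℤ Axj≡1 Axj′≡1 j<j′
    ... | t , j<t , t<j′ , Axt≡-1 = no-minuses-in-distinct-columns (rs t<j′) j<t Aij≡-1 Axt≡-1
    separate : Dec (a ≡ c) → Dec (a ≡ d) → Dec (b ≡ c) → Dec (b ≡ d) → ⊥
    separate (yes refl) _ _ _ = shared-row Aaj≡1 Acj′≡1
    separate _ (yes refl) _ _ = shared-row Aaj≡1 Adj′≡1
    separate _ _ (yes refl) _ = shared-row Abj≡1 Acj′≡1
    separate _ _ _ (yes refl) = shared-row Abj≡1 Adj′≡1
    separate (no a≢c) (no a≢d) (no b≢c) (no b≢d) =
      disjoint-pairs-of-ones-in-two-columns j<j′ Aaj≡1 Abj≡1 Acj′≡1 Adj′≡1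
        (Fin.<-trans a<i i<b) (Fin.<-trans c<i′ i′<d) a≢c a≢d b≢c b≢d

  avoidsAll⇒atMostOneMinus : AtMostOneMinus A
  avoidsAll⇒atMostOneMinus i j i′ j′ Aij≡-1 Ai′j′≡-1 with Fin.<-cmp j j′
  ... | tri< j<j′ _ _ = ⊥-elim (no-minuses-in-distinct-columns (<-wellFounded j′) j<j′ Aij≡-1 Ai′j′≡-1)
  ... | tri> _ _ j′<j = ⊥-elim (no-minuses-in-distinct-columns (<-wellFounded j) j′<j Ai′j′≡-1 Aij≡-1)
  ... | tri≈ _ refl _ with Fin.<-cmp i i′
  ...   | tri≈ _ i≡i′ _ = i≡i′ , refl
  ...   | tri< i<i′ _ _ = ⊥-elim (no-two-minuses-in-a-column Aij≡-1 Ai′j′≡-1 i<i′)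
  ...   | tri> _ _ i′<i = ⊥-elim (no-two-minuses-in-a-column Ai′j′≡-1 Aij≡-1 i′<i)

atMostOneMinus⇔avoidsAll : ∀ n (A : Mat n n) → IsASM A → AtMostOneMinus A ⇔ AvoidsAll A
atMostOneMinus⇔avoidsAll n A asm = mk⇔ (atMostOneMinus⇒avoidsAll A asm) (avoidsAll⇒atMostOneMinus A asm)

-- An order-preserving splitting of n positions into r marked and s unmarked ones.
data Mask : ℕ → ℕ → ℕ → Set where
  end  : Mask 0 0 0
  mark : ∀ {n r s} → Mask n r s → Mask (suc n) (suc r) s
  skip : ∀ {n r s} → Mask n r s → Mask (suc n) r (suc s)

marked : ∀ {n r s} → Mask n r s → Fin r → Fin n
marked (mark m) zero    = zero
marked (mark m) (suc p) = suc (marked m p)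
marked (skip m) p       = suc (marked m p)

unmarked : ∀ {n r s} → Mask n r s → Fin s → Fin n
unmarked (mark m) w       = suc (unmarked m w)
unmarked (skip m) zero    = zero
unmarked (skip m) (suc w) = suc (unmarked m w)

classify : ∀ {n r s} → Mask n r s → Fin n → Fin r ⊎ Fin s
classify (mark m) zero    = inj₁ zero
classify (mark m) (suc x) = Sum.map₁ suc (classify m x)
classify (skip m) zero    = inj₂ zero
classify (skip m) (suc x) = Sum.map₂ suc (classify m x)

embed : ∀ {n r s} → Mask n r s → Fin r ⊎ Fin s → Fin n
embed m = Sum.[ marked m , unmarked m ]

classify-embed : ∀ {n r s} (m : Mask n r s) z → classify m (embed m z) ≡ z
classify-embed (mark m) (inj₁ zero)    = refl
classify-embed (mark m) (inj₁ (suc p)) = cong (Sum.map₁ suc) (classify-embed m (inj₁ p))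
classify-embed (mark m) (inj₂ w)       = cong (Sum.map₁ suc) (classify-embed m (inj₂ w))
classify-embed (skip m) (inj₁ p)       = cong (Sum.map₂ suc) (classify-embed m (inj₁ p))
classify-embed (skip m) (inj₂ zero)    = refl
classify-embed (skip m) (inj₂ (suc w)) = cong (Sum.map₂ suc) (classify-embed m (inj₂ w))

embed-classify : ∀ {n r s} (m : Mask n r s) x → embed m (classify m x) ≡ x
embed-classify (mark m) zero = refl
embed-classify (skip m) zero = refl
embed-classify (mark m) (suc x) with classify m x | embed-classify m x
... | inj₁ p | e = cong suc e
... | inj₂ w | e = cong suc e
embed-classify (skip m) (suc x) with classify m x | embed-classify m x
... | inj₁ p | e = cong suc e
... | inj₂ w | e = cong suc e

embed-injective : ∀ {n r s} (m : Mask n r s) {z z′} → embed m z ≡ embed m z′ → z ≡ z′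
embed-injective m {z} {z′} e = trans (sym (classify-embed m z)) (trans (cong (classify m) e) (classify-embed m z′))

marked-strictMono : ∀ {n r s} (m : Mask n r s) → StrictMono (marked m)
marked-strictMono (mark m) zero    (suc q) _         = s<s z≤n
marked-strictMono (mark m) (suc p) (suc q) (s<s p<q) = s<s (marked-strictMono m p q p<q)
marked-strictMono (skip m) p       q       p<q       = s<s (marked-strictMono m p q p<q)

mask-ext : ∀ {n r s} {m m′ : Mask n r s} → (∀ p → marked m p ≡ marked m′ p) → m ≡ m′
mask-ext {m = end}    {end}     _    = refl
mask-ext {m = mark m} {mark m′} same = cong mark (mask-ext (Fin.suc-injective ∘ same ∘ suc))
mask-ext {m = skip m} {skip m′} same = cong skip (mask-ext (Fin.suc-injective ∘ same))
mask-ext {m = mark m} {skip m′} same with same zero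
... | ()
mask-ext {m = skip m} {mark m′} same with same zero
... | ()

mask-size : ∀ {n r s} → Mask n r s → r + s ≡ n
mask-size end                      = refl
mask-size (mark m)                 = cong suc (mask-size m)
mask-size {r = r} {suc s} (skip m) = trans (ℕ.+-suc r s) (cong suc (mask-size m))

private
  lowered : ∀ {n r} (e : Fin r → Fin (suc n)) → (∀ p → zero {n = n} < e p) → StrictMono e →
            ∃ λ (e′ : Fin r → Fin n) → StrictMono e′ × (∀ p → suc (e′ p) ≡ e p)
  lowered {n} {r} e e>0 e-mono = e′ , e′-mono , suc∘e′
    where
    e′ : Fin r → Fin n
    e′ p = punchOut (Fin.<⇒≢ (e>0 p))
    suc∘e′ : ∀ p → suc (e′ p) ≡ e p
    suc∘e′ p = Fin.punchIn-punchOut (Fin.<⇒≢ (e>0 p))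
    e′-mono : StrictMono e′
    e′-mono p q p<q = ℕ.s<s⁻¹ (subst₂ _<_ (sym (suc∘e′ p)) (sym (suc∘e′ q)) (e-mono p q p<q))

fromStrictMono : ∀ {n r} (e : Fin r → Fin n) → StrictMono e →
                 ∃₂ λ s (m : Mask n r s) → ∀ p → marked m p ≡ e p
fromStrictMono {zero}  {zero}  e e-mono = 0 , end , λ ()
fromStrictMono {zero}  {suc r} e e-mono with e zero
... | ()
fromStrictMono {suc n} {zero}  e e-mono =
  let s , m , _ = fromStrictMono {n} {zero} (λ ()) (λ ()) in suc s , skip m , λ ()
fromStrictMono {suc n} {suc r} e e-mono with e zero Fin.≟ zero
... | yes e₀≡0 =
  let e′ , e′-mono , suc∘e′ = lowered (e ∘ suc) tail>0 (λ p q → e-mono (suc p) (suc q) ∘ s<s)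
      s , m , marked≗e′ = fromStrictMono e′ e′-mono
  in  s , mark m , λ { zero → sym e₀≡0 ; (suc p) → trans (cong suc (marked≗e′ p)) (suc∘e′ p) }
  where
  tail>0 : ∀ p → zero {n = n} < e (suc p)
  tail>0 p = subst (_< e (suc p)) e₀≡0 (e-mono zero (suc p) z<s)
... | no e₀≢0 =
  let e′ , e′-mono , suc∘e′ = lowered e e>0 e-mono
      s , m , marked≗e′ = fromStrictMono e′ e′-mono
  in  suc s , skip m , λ p → trans (cong suc (marked≗e′ p)) (suc∘e′ p)
  where
  e>0 : ∀ p → zero {n = n} < e p
  e>0 zero    = Fin.≤∧≢⇒< z≤n (e₀≢0 ∘ sym)
  e>0 (suc p) = Fin.<-trans (e>0 zero) (e-mono zero (suc p) z<s)

masks : ∀ n r s → List (Mask n r s)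
masks zero    zero    zero    = end List.∷ List.[]
masks zero    zero    (suc s) = List.[]
masks zero    (suc r) s       = List.[]
masks (suc n) zero    zero    = List.[]
masks (suc n) (suc r) zero    = map mark (masks n r zero)
masks (suc n) zero    (suc s) = map skip (masks n zero s)
masks (suc n) (suc r) (suc s) = map mark (masks n r (suc s)) ++ map skip (masks n (suc r) s)

∈-masks : ∀ {n r s} (m : Mask n r s) → m ∈ masks n r s
∈-masks end                           = here refl
∈-masks {suc n} {suc r} {zero}  (mark m) = ∈.∈-map⁺ mark (∈-masks m)
∈-masks {suc n} {suc r} {suc s} (mark m) = ∈.∈-++⁺ˡ (∈.∈-map⁺ mark (∈-masks m))
∈-masks {suc n} {zero}  {suc s} (skip m) = ∈.∈-map⁺ skip (∈-masks m)
∈-masks {suc n} {suc r} {suc s} (skip m) = ∈.∈-++⁺ʳ (map mark (masks n r (suc s))) (∈.∈-map⁺ skip (∈-masks m))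

masks-unique : ∀ n r s → Unique (masks n r s)
masks-unique zero    zero    zero    = All.[] AllPairs.∷ AllPairs.[]
masks-unique zero    zero    (suc s) = AllPairs.[]
masks-unique zero    (suc r) s       = AllPairs.[]
masks-unique (suc n) zero    zero    = AllPairs.[]
masks-unique (suc n) (suc r) zero    = Unique.map⁺ mark-injective (masks-unique n r zero)
  where mark-injective : ∀ {n r s} {m m′ : Mask n r s} → mark m ≡ mark m′ → m ≡ m′
        mark-injective refl = refl
masks-unique (suc n) zero    (suc s) = Unique.map⁺ skip-injective (masks-unique n zero s)
  where skip-injective : ∀ {n r s} {m m′ : Mask n r s} → skip m ≡ skip m′ → m ≡ m′
        skip-injective refl = refl
masks-unique (suc n) (suc r) (suc s) =
  Unique.++⁺ (Unique.map⁺ mark-injective (masks-unique n r (suc s)))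
             (Unique.map⁺ skip-injective (masks-unique n (suc r) s)) disjoint
  where
  mark-injective : ∀ {n r s} {m m′ : Mask n r s} → mark m ≡ mark m′ → m ≡ m′
  mark-injective refl = refl
  skip-injective : ∀ {n r s} {m m′ : Mask n r s} → skip m ≡ skip m′ → m ≡ m′
  skip-injective refl = refl
  disjoint : ∀ {m} → ¬ (m ∈ map mark (masks n r (suc s)) × m ∈ map skip (masks n (suc r) s))
  disjoint (m∈marks , m∈skips) with ∈.∈-map⁻ mark m∈marks | ∈.∈-map⁻ skip m∈skips
  ... | _ , _ , refl | _ , _ , ()

length-masks : ∀ n r s → n ≡ r + s → length (masks n r s) ≡ n C r
length-masks zero    zero    zero    _ = refl
length-masks zero    zero    (suc s) ()
length-masks zero    (suc r) s       ()
length-masks (suc n) zero    zero    ()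
length-masks (suc n) (suc r) zero    n≡r+0 = begin
  length (map mark (masks n r zero)) ≡⟨ List.length-map mark (masks n r zero) ⟩
  length (masks n r zero)            ≡⟨ length-masks n r zero (ℕ.suc-injective n≡r+0) ⟩
  n C r                              ≡⟨ cong (_C r) n≡r ⟩
  r C r                              ≡⟨ trans (nCn≡1 r) (sym (nCn≡1 (suc r))) ⟩
  suc r C suc r                      ≡⟨ cong (λ m → suc m C suc r) n≡r ⟨
  suc n C suc r                      ∎
  where
  open ≡-Reasoning
  n≡r : n ≡ r
  n≡r = trans (ℕ.suc-injective n≡r+0) (ℕ.+-identityʳ r)
length-masks (suc n) zero    (suc s) n≡s =
  trans (List.length-map skip (masks n zero s)) (length-masks n zero s (ℕ.suc-injective n≡s))
length-masks (suc n) (suc r) (suc s) n≡r+s = begin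
  length (map mark (masks n r (suc s)) ++ map skip (masks n (suc r) s))
    ≡⟨ List.length-++ (map mark (masks n r (suc s))) ⟩
  length (map mark (masks n r (suc s))) + length (map skip (masks n (suc r) s))
    ≡⟨ cong₂ _+_ (List.length-map mark (masks n r (suc s))) (List.length-map skip (masks n (suc r) s)) ⟩
  length (masks n r (suc s)) + length (masks n (suc r) s)
    ≡⟨ cong₂ _+_ (length-masks n r (suc s) (ℕ.suc-injective n≡r+s))
                 (length-masks n (suc r) s (trans (ℕ.suc-injective n≡r+s) (ℕ.+-suc r s))) ⟩
  n C r + n C suc r
    ≡⟨ nCk+nC[k+1]≡[n+1]C[k+1] n r ⟩
  suc n C suc r ∎
  where open ≡-Reasoning

unmarked-injective : ∀ {n r s} (m : Mask n r s) {w w′} → unmarked m w ≡ unmarked m w′ → w ≡ w′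
unmarked-injective m {w} {w′} e with embed-injective m {inj₂ w} {inj₂ w′} e
... | refl = refl

unmarked≢marked : ∀ {n r s} (m : Mask n r s) {w p} → unmarked m w ≢ marked m p
unmarked≢marked m {w} {p} e with embed-injective m {inj₂ w} {inj₁ p} e
... | ()

maskThrough : ∀ {n} (xs : Vec (Fin n) 3) → Linked _<_ xs → Σ (Mask n 3 (n ∸ 3)) λ m → ∀ p → marked m p ≡ lookup xs p
maskThrough {n} xs sorted with fromStrictMono (lookup xs) (lookup-strictMono sorted)
... | s , m , marked≗ with trans (sym (ℕ.m+n∸m≡n 3 s)) (cong (_∸ 3) (mask-size m))
...   | refl = m , marked≗

length-cartesianProductWith : ∀ {a b c} {A : Set a} {B : Set b} {C : Set c} (f : A → B → C) xs ys →
                              length (cartesianProductWith f xs ys) ≡ length xs * length ys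
length-cartesianProductWith f List.[]       ys = refl
length-cartesianProductWith f (x List.∷ xs) ys =
  trans (List.length-++ (map (f x) ys))
        (cong₂ _+_ (List.length-map (f x) ys) (length-cartesianProductWith f xs ys))

IsPermutation : ∀ {k} → Vec (Fin k) k → Set
IsPermutation π = Injective _≡_ _≡_ (lookup π) × ∀ y → ∃ λ x → lookup π x ≡ y

extend : ∀ {k} → Fin (suc k) → Vec (Fin k) k → Vec (Fin (suc k)) (suc k)
extend c π = c ∷ V.map (punchIn c) π

permutations : ∀ k → List (Vec (Fin k) k)
permutations zero    = [] List.∷ List.[]
permutations (suc k) = cartesianProductWith extend (allFin (suc k)) (permutations k)

length-permutations : ∀ k → length (permutations k) ≡ k !
length-permutations zero    = refl
length-permutations (suc k) =
  trans (length-cartesianProductWith extend (allFin (suc k)) (permutations k))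
        (cong₂ _*_ (List.length-tabulate {n = suc k} (λ x → x)) (length-permutations k))

extend-injective : ∀ {k} {c c′ : Fin (suc k)} {π π′} → extend c π ≡ extend c′ π′ → c ≡ c′ × π ≡ π′
extend-injective {c = c} {π = π} {π′} e with Vec.∷-injective e
... | refl , punched = refl , lookup-ext λ x →
  Fin.punchIn-injective c _ _ (trans (sym (Vec.lookup-map x (punchIn c) π))
                                     (trans (cong (λ v → lookup v x) punched) (Vec.lookup-map x (punchIn c) π′)))

permutations-unique : ∀ k → Unique (permutations k)
permutations-unique zero    = All.[] AllPairs.∷ AllPairs.[]
permutations-unique (suc k) =
  Unique.cartesianProductWith⁺ extend extend-injective (Unique.allFin⁺ (suc k)) (permutations-unique k)

∈permutations⇒isPermutation : ∀ {k} {π : Vec (Fin k) k} → π ∈ permutations k → IsPermutation π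
∈permutations⇒isPermutation {zero}  {[]} _ = (λ {}) , λ ()
∈permutations⇒isPermutation {suc k} π∈
  with ∈.∈-cartesianProductWith⁻ extend (allFin (suc k)) (permutations k) π∈
... | c , π , _ , π∈′ , refl = injective , surjective
  where
  π-perm : IsPermutation π
  π-perm = ∈permutations⇒isPermutation π∈′
  lookup-extend : ∀ x → lookup (extend c π) (suc x) ≡ punchIn c (lookup π x)
  lookup-extend x = Vec.lookup-map x (punchIn c) π
  injective : Injective _≡_ _≡_ (lookup (extend c π))
  injective {zero}  {zero}  _ = refl
  injective {zero}  {suc y} e = ⊥-elim (Fin.punchInᵢ≢i c (lookup π y) (sym (trans e (lookup-extend y))))
  injective {suc x} {zero}  e = ⊥-elim (Fin.punchInᵢ≢i c (lookup π x) (trans (sym (lookup-extend x)) e))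
  injective {suc x} {suc y} e = cong suc (proj₁ π-perm
    (Fin.punchIn-injective c _ _ (trans (sym (lookup-extend x)) (trans e (lookup-extend y)))))
  surjective : ∀ y → ∃ λ x → lookup (extend c π) x ≡ y
  surjective y with c Fin.≟ y
  ... | yes c≡y = zero , c≡y
  ... | no c≢y =
    let x , πx≡ = proj₂ π-perm (punchOut c≢y)
    in  suc x , trans (lookup-extend x) (trans (cong (punchIn c) πx≡) (Fin.punchIn-punchOut c≢y))

injective⇒∈permutations : ∀ {k} (π : Vec (Fin k) k) → Injective _≡_ _≡_ (lookup π) → π ∈ permutations k
injective⇒∈permutations {zero}  []      _ = here refl
injective⇒∈permutations {suc k} (c ∷ π) injective =
  subst (_∈ permutations (suc k)) extend-π′≡
    (∈.∈-cartesianProductWith⁺ extend (∈.∈-allFin c) (injective⇒∈permutations π′ π′-injective))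
  where
  c≢ : ∀ x → c ≢ lookup π x
  c≢ x e with injective {zero} {suc x} e
  ... | ()
  π′ : Vec (Fin k) k
  π′ = tabulate λ x → punchOut (c≢ x)
  lookup-π′ : ∀ x → lookup π′ x ≡ punchOut (c≢ x)
  lookup-π′ = Vec.lookup∘tabulate (λ x → punchOut (c≢ x))
  π′-injective : Injective _≡_ _≡_ (lookup π′)
  π′-injective {x} {y} e = Fin.suc-injective (injective
    (Fin.punchOut-injective (c≢ x) (c≢ y) (trans (sym (lookup-π′ x)) (trans e (lookup-π′ y)))))
  extend-π′≡ : extend c π′ ≡ c ∷ π
  extend-π′≡ = cong (c ∷_) (lookup-ext λ x →
    trans (Vec.lookup-map x (punchIn c) π′) (trans (cong (punchIn c) (lookup-π′ x)) (Fin.punchIn-punchOut (c≢ x))))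

wordMat-injective : ∀ {m r} {w w′ : Vec (Fin r) m} → wordMat w ≡ wordMat w′ → w ≡ w′
wordMat-injective {w = w} {w′} same = lookup-ext λ i → sym (indicator≡1
  (trans (sym (wordMat-entry w′ i (lookup w i)))
    (trans (cong (λ M → M ⟨ i , lookup w i ⟩) (sym same)) (trans (wordMat-entry w i _) (indicator-same _)))))

wordMat-signs : ∀ {m r} (w : Vec (Fin r) m) → Entries01 (wordMat w)
wordMat-signs w i j rewrite wordMat-entry w i j = indicator-signs (lookup w i) j

wordMat-no-minus : ∀ {m r} (w : Vec (Fin r) m) i j → wordMat w ⟨ i , j ⟩ ≢ -1ℤ
wordMat-no-minus w i j = indicator≢-1 (lookup w i) j ∘ trans (sym (wordMat-entry w i j))

permutationMatrix-asm : ∀ {k} (π : Vec (Fin k) k) → IsPermutation π → IsASM (wordMat π)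
permutationMatrix-asm π (injective , surjective) = asm-from-shapes (wordMat π) (wordMat-signs π) row-shape column-shape
  where
  row-shape : ∀ i → LineShape (lookup (lookup (wordMat π) i))
  row-shape i = inj₁ (lookup π i , record
    { one-at-p       = trans (wordMat-entry π i _) (indicator-same _)
    ; zero-elsewhere = λ t t≢πi → trans (wordMat-entry π i t) (indicator-other (t≢πi ∘ sym)) })
  column-shape : ∀ j → LineShape (column (wordMat π) j)
  column-shape j = let x , πx≡j = surjective j in inj₁ (x , record
    { one-at-p       = trans (wordMat-entry π x j) (subst (λ y → indicator (lookup π x) y ≡ 1ℤ) πx≡j (indicator-same _))
    ; zero-elsewhere = λ t t≢x → trans (wordMat-entry π t j) (indicator-other λ πt≡j → t≢x (injective (trans πt≡j (sym πx≡j)))) })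

module _ {n r s} (m : Mask n r s) (f : Fin r ⊎ Fin s → ℤ) where

  private
    classify≢ : ∀ {t z} → t ≢ embed m z → classify m t ≢ z
    classify≢ {t} t≢ e = t≢ (trans (sym (embed-classify m t)) (cong (embed m) e))

  unit-along : ∀ z → f z ≡ 1ℤ → (∀ z′ → z′ ≢ z → f z′ ≡ 0ℤ) → IsUnitAt (f ∘ classify m) (embed m z)
  unit-along z fz≡1 zero-elsewhere = record
    { one-at-p       = trans (cong f (classify-embed m z)) fz≡1
    ; zero-elsewhere = λ t t≢ → zero-elsewhere (classify m t) (classify≢ t≢) }

  bump-along : ∀ {p q r} → p < q → q < r → f (inj₁ p) ≡ 1ℤ → f (inj₁ q) ≡ -1ℤ → f (inj₁ r) ≡ 1ℤ →
               (∀ z → z ≢ inj₁ p → z ≢ inj₁ q → z ≢ inj₁ r → f z ≡ 0ℤ) →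
               IsBumpAt (f ∘ classify m) (marked m p) (marked m q) (marked m r)
  bump-along {p} {q} {r} p<q q<r fp≡1 fq≡-1 fr≡1 zero-elsewhere = record
    { p<q            = marked-strictMono m p q p<q
    ; q<r            = marked-strictMono m q r q<r
    ; one-at-p       = trans (cong f (classify-embed m (inj₁ p))) fp≡1
    ; minus-at-q     = trans (cong f (classify-embed m (inj₁ q))) fq≡-1
    ; one-at-r       = trans (cong f (classify-embed m (inj₁ r))) fr≡1
    ; zero-elsewhere = λ t t≢p t≢q t≢r → zero-elsewhere (classify m t) (classify≢ t≢p) (classify≢ t≢q) (classify≢ t≢r) }

diamond : Fin 3 → Fin 3 → ℤ
diamond 1F 1F = -1ℤ
diamond 1F _  = 1ℤ
diamond _  1F = 1ℤ
diamond _  _  = 0ℤ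

blockEntry : ∀ {k} → Vec (Fin k) k → Fin 3 ⊎ Fin k → Fin 3 ⊎ Fin k → ℤ
blockEntry π (inj₁ p) (inj₁ q) = diamond p q
blockEntry π (inj₂ u) (inj₂ w) = indicator (lookup π u) w
blockEntry π _        _        = 0ℤ

-- The block matrix diag(diamond, π), spread over the rows and columns picked by two masks.
decode : ∀ {n k} → Mask n 3 k → Mask n 3 k → Vec (Fin k) k → Mat n n
decode mr mc π = tabulate λ x → tabulate λ y → blockEntry π (classify mr x) (classify mc y)

module Decode {n k} (mr mc : Mask n 3 k) (π : Vec (Fin k) k) where

  D : Mat n n
  D = decode mr mc π

  entry : ∀ x y → D ⟨ x , y ⟩ ≡ blockEntry π (classify mr x) (classify mc y)
  entry = entry-tabulate (λ x y → blockEntry π (classify mr x) (classify mc y))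

  entry-embed : ∀ z z′ → D ⟨ embed mr z , embed mc z′ ⟩ ≡ blockEntry π z z′
  entry-embed z z′ = trans (entry _ _) (cong₂ (blockEntry π) (classify-embed mr z) (classify-embed mc z′))

  signs : Entries01 D
  signs x y rewrite entry x y = block-signs (classify mr x) (classify mc y)
    where
    block-signs : ∀ z z′ → blockEntry π z z′ ≡ 0ℤ ⊎ blockEntry π z z′ ≡ 1ℤ ⊎ blockEntry π z z′ ≡ -1ℤ
    block-signs (inj₁ 0F) (inj₁ 0F) = inj₁ refl
    block-signs (inj₁ 0F) (inj₁ 1F) = inj₂ (inj₁ refl)
    block-signs (inj₁ 0F) (inj₁ 2F) = inj₁ refl
    block-signs (inj₁ 1F) (inj₁ 0F) = inj₂ (inj₁ refl)
    block-signs (inj₁ 1F) (inj₁ 1F) = inj₂ (inj₂ refl)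
    block-signs (inj₁ 1F) (inj₁ 2F) = inj₂ (inj₁ refl)
    block-signs (inj₁ 2F) (inj₁ 0F) = inj₁ refl
    block-signs (inj₁ 2F) (inj₁ 1F) = inj₂ (inj₁ refl)
    block-signs (inj₁ 2F) (inj₁ 2F) = inj₁ refl
    block-signs (inj₁ _)  (inj₂ _)  = inj₁ refl
    block-signs (inj₂ _)  (inj₁ _)  = inj₁ refl
    block-signs (inj₂ u)  (inj₂ w)  = indicator-signs (lookup π u) w

  minus-location : ∀ x y → D ⟨ x , y ⟩ ≡ -1ℤ → x ≡ marked mr 1F × y ≡ marked mc 1F
  minus-location x y Dxy≡-1 =
    located (classify mr x) (classify mc y) (embed-classify mr x) (embed-classify mc y) (trans (sym (entry x y)) Dxy≡-1)
    where
    located : ∀ z z′ → embed mr z ≡ x → embed mc z′ ≡ y → blockEntry π z z′ ≡ -1ℤ → x ≡ marked mr 1F × y ≡ marked mc 1F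
    located (inj₁ 1F) (inj₁ 1F) refl refl _ = refl , refl
    located (inj₂ u)  (inj₂ w)  _    _    e = ⊥-elim (indicator≢-1 (lookup π u) w e)
    located (inj₁ 0F) (inj₁ 0F) _ _ ()
    located (inj₁ 0F) (inj₁ 1F) _ _ ()
    located (inj₁ 0F) (inj₁ 2F) _ _ ()
    located (inj₁ 1F) (inj₁ 0F) _ _ ()
    located (inj₁ 1F) (inj₁ 2F) _ _ ()
    located (inj₁ 2F) (inj₁ 0F) _ _ ()
    located (inj₁ 2F) (inj₁ 1F) _ _ ()
    located (inj₁ 2F) (inj₁ 2F) _ _ ()
    located (inj₁ _)  (inj₂ _)  _ _ ()
    located (inj₂ _)  (inj₁ _)  _ _ ()

  atMostOneMinus : AtMostOneMinus D
  atMostOneMinus i j i′ j′ Dij≡-1 Di′j′≡-1 with minus-location i j Dij≡-1 | minus-location i′ j′ Di′j′≡-1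
  ... | refl , refl | refl , refl = refl , refl

  private
    middle-block-row : IsBumpAt (blockEntry π (inj₁ 1F) ∘ classify mc) (marked mc 0F) (marked mc 1F) (marked mc 2F)
    middle-block-row = bump-along mc (blockEntry π (inj₁ 1F)) z<s (s<s z<s) refl refl refl λ
      { (inj₁ 0F) ≢0 _ _ → ⊥-elim (≢0 refl) ; (inj₁ 1F) _ ≢1 _ → ⊥-elim (≢1 refl)
      ; (inj₁ 2F) _ _ ≢2 → ⊥-elim (≢2 refl) ; (inj₂ _) _ _ _ → refl }

    middle-block-column : IsBumpAt ((λ z → blockEntry π z (inj₁ 1F)) ∘ classify mr) (marked mr 0F) (marked mr 1F) (marked mr 2F)
    middle-block-column = bump-along mr (λ z → blockEntry π z (inj₁ 1F)) z<s (s<s z<s) refl refl refl λ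
      { (inj₁ 0F) ≢0 _ _ → ⊥-elim (≢0 refl) ; (inj₁ 1F) _ ≢1 _ → ⊥-elim (≢1 refl)
      ; (inj₁ 2F) _ _ ≢2 → ⊥-elim (≢2 refl) ; (inj₂ _) _ _ _ → refl }

  middle-row : IsBumpAt (lookup (lookup D (marked mr 1F))) (marked mc 0F) (marked mc 1F) (marked mc 2F)
  middle-row = bump-cong (λ y → trans (cong (λ z → blockEntry π z (classify mc y)) (sym (classify-embed mr (inj₁ 1F))))
                                      (sym (entry (marked mr 1F) y)))
                         middle-block-row

  middle-column : IsBumpAt (column D (marked mc 1F)) (marked mr 0F) (marked mr 1F) (marked mr 2F)
  middle-column = bump-cong (λ x → trans (cong (blockEntry π (classify mr x)) (sym (classify-embed mc (inj₁ 1F))))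
                                         (sym (entry x (marked mc 1F))))
                            middle-block-column

  row-shape : ∀ x → LineShape (lookup (lookup D x))
  row-shape x = lineShape-cong (λ y → sym (entry x y)) (block-row (classify mr x))
    where
    block-row : ∀ z → LineShape (blockEntry π z ∘ classify mc)
    block-row (inj₁ 0F) = inj₁ (_ , unit-along mc (blockEntry π (inj₁ 0F)) (inj₁ 1F) refl λ
      { (inj₁ 0F) _ → refl ; (inj₁ 1F) ≢1 → ⊥-elim (≢1 refl) ; (inj₁ 2F) _ → refl ; (inj₂ _) _ → refl })
    block-row (inj₁ 1F) = inj₂ (_ , _ , _ , middle-block-row)
    block-row (inj₁ 2F) = inj₁ (_ , unit-along mc (blockEntry π (inj₁ 2F)) (inj₁ 1F) refl λ
      { (inj₁ 0F) _ → refl ; (inj₁ 1F) ≢1 → ⊥-elim (≢1 refl) ; (inj₁ 2F) _ → refl ; (inj₂ _) _ → refl })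
    block-row (inj₂ u)  = inj₁ (_ , unit-along mc (blockEntry π (inj₂ u)) (inj₂ (lookup π u)) (indicator-same _) λ
      { (inj₁ _) _ → refl ; (inj₂ w) ≢πu → indicator-other (≢πu ∘ cong inj₂ ∘ sym) })

  column-shape : IsPermutation π → ∀ y → LineShape (column D y)
  column-shape (injective , surjective) y = lineShape-cong (λ x → sym (entry x y)) (block-column (classify mc y))
    where
    block-column : ∀ z′ → LineShape ((λ z → blockEntry π z z′) ∘ classify mr)
    block-column (inj₁ 0F) = inj₁ (_ , unit-along mr (λ z → blockEntry π z (inj₁ 0F)) (inj₁ 1F) refl λ
      { (inj₁ 0F) _ → refl ; (inj₁ 1F) ≢1 → ⊥-elim (≢1 refl) ; (inj₁ 2F) _ → refl ; (inj₂ _) _ → refl })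
    block-column (inj₁ 1F) = inj₂ (_ , _ , _ , middle-block-column)
    block-column (inj₁ 2F) = inj₁ (_ , unit-along mr (λ z → blockEntry π z (inj₁ 2F)) (inj₁ 1F) refl λ
      { (inj₁ 0F) _ → refl ; (inj₁ 1F) ≢1 → ⊥-elim (≢1 refl) ; (inj₁ 2F) _ → refl ; (inj₂ _) _ → refl })
    block-column (inj₂ w)  =
      let u , πu≡w = surjective w
      in  inj₁ (_ , unit-along mr (λ z → blockEntry π z (inj₂ w)) (inj₂ u)
                      (subst (λ y → indicator (lookup π u) y ≡ 1ℤ) πu≡w (indicator-same _)) λ
            { (inj₁ _) _ → refl
            ; (inj₂ t) ≢u → indicator-other λ πt≡w → ≢u (cong inj₂ (injective (trans πt≡w (sym πu≡w)))) })

  asm : IsPermutation π → IsASM D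
  asm perm = asm-from-shapes D signs row-shape (column-shape perm)

decode-injective : ∀ {n k} {mr mc mr′ mc′ : Mask n 3 k} {π π′} →
                   decode mr mc π ≡ decode mr′ mc′ π′ → mr ≡ mr′ × mc ≡ mc′ × π ≡ π′
decode-injective {mr = mr} {mc} {mr′} {mc′} {π} {π′} same = conclude (mask-ext rows-agree) (mask-ext columns-agree)
  where
  module X = Decode mr mc π
  module Y = Decode mr′ mc′ π′
  in-X : ∀ {x y} → Y.D ⟨ x , y ⟩ ≡ X.D ⟨ x , y ⟩
  in-X {x} {y} = cong (λ M → M ⟨ x , y ⟩) (sym same)
  centre : marked mr′ 1F ≡ marked mr 1F × marked mc′ 1F ≡ marked mc 1F
  centre = X.minus-location _ _ (trans (sym in-X) (Y.entry-embed (inj₁ 1F) (inj₁ 1F)))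
  column-ends : marked mr′ 0F ≡ marked mr 0F × marked mr′ 2F ≡ marked mr 2F
  column-ends = bump-ends-unique X.middle-column
    (bump-cong (λ x → trans in-X (cong (λ y → X.D ⟨ x , y ⟩) (proj₂ centre))) Y.middle-column)
  row-ends : marked mc′ 0F ≡ marked mc 0F × marked mc′ 2F ≡ marked mc 2F
  row-ends = bump-ends-unique X.middle-row
    (bump-cong (λ y → trans in-X (cong (λ x → X.D ⟨ x , y ⟩) (proj₁ centre))) Y.middle-row)
  rows-agree : ∀ p → marked mr p ≡ marked mr′ p
  rows-agree 0F = sym (proj₁ column-ends)
  rows-agree 1F = sym (proj₁ centre)
  rows-agree 2F = sym (proj₂ column-ends)
  columns-agree : ∀ p → marked mc p ≡ marked mc′ p
  columns-agree 0F = sym (proj₁ row-ends)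
  columns-agree 1F = sym (proj₂ centre)
  columns-agree 2F = sym (proj₂ row-ends)
  conclude : mr ≡ mr′ → mc ≡ mc′ → mr ≡ mr′ × mc ≡ mc′ × π ≡ π′
  conclude refl refl = refl , refl , lookup-ext λ u → indicator≡1
    (trans (sym (X.entry-embed (inj₂ u) (inj₂ (lookup π′ u))))
      (trans (sym in-X) (trans (Y.entry-embed (inj₂ u) (inj₂ (lookup π′ u))) (indicator-same _))))

module NoMinus {n} (A : Mat n n) (asm : IsASM A) (no-minus : ∀ i j → A ⟨ i , j ⟩ ≢ -1ℤ) where
  open ASM A asm

  private
    row-unit : ∀ i → ∃ (IsUnitAt (lookup (lookup A i)))
    row-unit i = unit-row i (no-minus i)

  π : Vec (Fin n) n
  π = tabulate (proj₁ ∘ row-unit)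

  private
    unit-at-π : ∀ i → IsUnitAt (lookup (lookup A i)) (lookup π i)
    unit-at-π i = subst (IsUnitAt (lookup (lookup A i))) (sym (Vec.lookup∘tabulate (proj₁ ∘ row-unit) i)) (proj₂ (row-unit i))

  π-injective : Injective _≡_ _≡_ (lookup π)
  π-injective {x} {x′} πx≡πx′ =
    let _ , column-unit = unit-column (lookup π x) (λ t → no-minus t _)
    in  trans (unit-position column-unit (IsUnitAt.one-at-p (unit-at-π x)))
              (sym (unit-position column-unit (subst (λ y → A ⟨ x′ , y ⟩ ≡ 1ℤ) (sym πx≡πx′) (IsUnitAt.one-at-p (unit-at-π x′)))))

  ≡permutationMatrix : A ≡ wordMat π
  ≡permutationMatrix = entry-ext λ x y → trans (row-entry x y) (sym (wordMat-entry π x y))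
    where
    row-entry : ∀ x y → A ⟨ x , y ⟩ ≡ indicator (lookup π x) y
    row-entry x y with lookup π x Fin.≟ y
    ... | yes refl = IsUnitAt.one-at-p (unit-at-π x)
    ... | no πx≢y  = IsUnitAt.zero-elsewhere (unit-at-π x) y (πx≢y ∘ sym)

module OneMinus {n} (A : Mat n n) (asm : IsASM A) (at-most-one : AtMostOneMinus A)
                {i j : Fin n} (Aij≡-1 : A ⟨ i , j ⟩ ≡ -1ℤ)
                {a b c d : Fin n} (column-bump : IsBumpAt (column A j) a i b) (row-bump : IsBumpAt (lookup (lookup A i)) c j d)
                {k} (mr mc : Mask n 3 k)
                (mr≗ : ∀ p → marked mr p ≡ lookup (a ∷ i ∷ b ∷ []) p)
                (mc≗ : ∀ q → marked mc q ≡ lookup (c ∷ j ∷ d ∷ []) q) where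
  open ASM A asm
  private
    module Col = IsBumpAt column-bump
    module Row = IsBumpAt row-bump

    off-row : ∀ {x} → x ≢ i → ∀ t → A ⟨ x , t ⟩ ≢ -1ℤ
    off-row x≢i t Axt≡-1 = x≢i (proj₁ (at-most-one _ t i j Axt≡-1 Aij≡-1))

    off-column : ∀ {y} → y ≢ j → ∀ t → A ⟨ t , y ⟩ ≢ -1ℤ
    off-column y≢j t Aty≡-1 = y≢j (proj₂ (at-most-one t _ i j Aty≡-1 Aij≡-1))

    row-only : ∀ {x y} → x ≢ i → A ⟨ x , y ⟩ ≡ 1ℤ → ∀ t → t ≢ y → A ⟨ x , t ⟩ ≡ 0ℤ
    row-only x≢i = unit-zero-elsewhere (proj₂ (unit-row _ (off-row x≢i)))

    column-only : ∀ {x y} → y ≢ j → A ⟨ x , y ⟩ ≡ 1ℤ → ∀ t → t ≢ x → A ⟨ t , y ⟩ ≡ 0ℤ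
    column-only y≢j = unit-zero-elsewhere (proj₂ (unit-column _ (off-column y≢j)))

    diamond-row diamond-column : Fin 3 → Fin n
    diamond-row    = lookup (a ∷ i ∷ b ∷ [])
    diamond-column = lookup (c ∷ j ∷ d ∷ [])

    a≢i : a ≢ i
    a≢i = Fin.<⇒≢ Col.p<q
    b≢i : b ≢ i
    b≢i = Fin.<⇒≢ Col.q<r ∘ sym
    c≢j : c ≢ j
    c≢j = Fin.<⇒≢ Row.p<q
    d≢j : d ≢ j
    d≢j = Fin.<⇒≢ Row.q<r ∘ sym

    unmarked-row≢ : ∀ u p → unmarked mr u ≢ diamond-row p
    unmarked-row≢ u p = unmarked≢marked mr ∘ flip trans (sym (mr≗ p))
    unmarked-column≢ : ∀ w q → unmarked mc w ≢ diamond-column q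
    unmarked-column≢ w q = unmarked≢marked mc ∘ flip trans (sym (mc≗ q))

    on-diamond : ∀ p q → A ⟨ diamond-row p , diamond-column q ⟩ ≡ diamond p q
    on-diamond 0F 0F = row-only a≢i Col.one-at-p c c≢j
    on-diamond 0F 1F = Col.one-at-p
    on-diamond 0F 2F = row-only a≢i Col.one-at-p d d≢j
    on-diamond 1F 0F = Row.one-at-p
    on-diamond 1F 1F = Aij≡-1
    on-diamond 1F 2F = Row.one-at-r
    on-diamond 2F 0F = row-only b≢i Col.one-at-r c c≢j
    on-diamond 2F 1F = Col.one-at-r
    on-diamond 2F 2F = row-only b≢i Col.one-at-r d d≢j

    diamond-row-elsewhere : ∀ p w → A ⟨ diamond-row p , unmarked mc w ⟩ ≡ 0ℤ
    diamond-row-elsewhere 0F w = row-only a≢i Col.one-at-p _ (unmarked-column≢ w 1F)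
    diamond-row-elsewhere 1F w = Row.zero-elsewhere _ (unmarked-column≢ w 0F) (unmarked-column≢ w 1F) (unmarked-column≢ w 2F)
    diamond-row-elsewhere 2F w = row-only b≢i Col.one-at-r _ (unmarked-column≢ w 1F)

    diamond-column-elsewhere : ∀ u q → A ⟨ unmarked mr u , diamond-column q ⟩ ≡ 0ℤ
    diamond-column-elsewhere u 0F = column-only c≢j Row.one-at-p _ (unmarked-row≢ u 1F)
    diamond-column-elsewhere u 1F = Col.zero-elsewhere _ (unmarked-row≢ u 0F) (unmarked-row≢ u 1F) (unmarked-row≢ u 2F)
    diamond-column-elsewhere u 2F = column-only d≢j Row.one-at-r _ (unmarked-row≢ u 1F)

    unmarked-marked : ∀ u q → A ⟨ unmarked mr u , marked mc q ⟩ ≡ 0ℤ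
    unmarked-marked u q = trans (cong (λ y → A ⟨ unmarked mr u , y ⟩) (mc≗ q)) (diamond-column-elsewhere u q)

    π-choice : ∀ u → ∃ λ w → A ⟨ unmarked mr u , unmarked mc w ⟩ ≡ 1ℤ
    π-choice u with unit-row (unmarked mr u) (off-row (unmarked-row≢ u 1F))
    ... | y , unit with classify mc y | embed-classify mc y
    ...   | inj₂ w | refl = w , IsUnitAt.one-at-p unit
    ...   | inj₁ q | refl = ⊥-elim (1ℤ≢0ℤ (trans (sym (IsUnitAt.one-at-p unit)) (unmarked-marked u q)))

  π : Vec (Fin k) k
  π = tabulate (proj₁ ∘ π-choice)

  private
    one-at-π : ∀ u → A ⟨ unmarked mr u , unmarked mc (lookup π u) ⟩ ≡ 1ℤ
    one-at-π u = subst (λ w → A ⟨ unmarked mr u , unmarked mc w ⟩ ≡ 1ℤ)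
                       (sym (Vec.lookup∘tabulate (proj₁ ∘ π-choice) u)) (proj₂ (π-choice u))

    unmarked-unmarked : ∀ u w → A ⟨ unmarked mr u , unmarked mc w ⟩ ≡ indicator (lookup π u) w
    unmarked-unmarked u w with lookup π u Fin.≟ w
    ... | yes refl = one-at-π u
    ... | no πu≢w  = row-only (unmarked-row≢ u 1F) (one-at-π u) _ (πu≢w ∘ sym ∘ unmarked-injective mc)

  π-injective : Injective _≡_ _≡_ (lookup π)
  π-injective {u} {u′} πu≡πu′ = decidable-stable (u Fin.≟ u′) λ u≢u′ →
    1ℤ≢0ℤ (trans (sym (subst (λ w → A ⟨ unmarked mr u′ , unmarked mc w ⟩ ≡ 1ℤ) (sym πu≡πu′) (one-at-π u′)))
      (column-only (unmarked-column≢ (lookup π u) 1F) (one-at-π u) (unmarked mr u′)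
        (u≢u′ ∘ sym ∘ unmarked-injective mr)))

  ≡decode : A ≡ decode mr mc π
  ≡decode = entry-ext λ x y → begin
    A ⟨ x , y ⟩
      ≡⟨ cong₂ (λ x y → A ⟨ x , y ⟩) (embed-classify mr x) (embed-classify mc y) ⟨
    A ⟨ embed mr (classify mr x) , embed mc (classify mc y) ⟩
      ≡⟨ block (classify mr x) (classify mc y) ⟩
    blockEntry π (classify mr x) (classify mc y)
      ≡⟨ Decode.entry mr mc π x y ⟨
    decode mr mc π ⟨ x , y ⟩ ∎
    where
    open ≡-Reasoning
    block : ∀ z z′ → A ⟨ embed mr z , embed mc z′ ⟩ ≡ blockEntry π z z′
    block (inj₁ p) (inj₁ q) = trans (cong₂ (λ x y → A ⟨ x , y ⟩) (mr≗ p) (mc≗ q)) (on-diamond p q)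
    block (inj₁ p) (inj₂ w) = trans (cong (λ x → A ⟨ x , unmarked mc w ⟩) (mr≗ p)) (diamond-row-elsewhere p w)
    block (inj₂ u) (inj₁ q) = unmarked-marked u q
    block (inj₂ u) (inj₂ w) = unmarked-unmarked u w

permutationMatrices : ∀ n → List (Mat n n)
permutationMatrices n = map wordMat (permutations n)

decodeCode : ∀ {n k} → Mask n 3 k → Mask n 3 k × Vec (Fin k) k → Mat n n
decodeCode mr (mc , π) = decode mr mc π

-- For n < 3 there are no masks, so this list is empty.
oneMinusMatrices : ∀ n → List (Mat n n)
oneMinusMatrices n =
  cartesianProductWith decodeCode (masks n 3 (n ∸ 3)) (cartesianProduct (masks n 3 (n ∸ 3)) (permutations (n ∸ 3)))

atMostOneMinusASMs : ∀ n → List (Mat n n)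
atMostOneMinusASMs n = permutationMatrices n ++ oneMinusMatrices n

module _ {n : ℕ} where

  ∈permutationMatrices⇒ : ∀ {A : Mat n n} → A ∈ permutationMatrices n → IsASM A × AtMostOneMinus A
  ∈permutationMatrices⇒ A∈ with ∈.∈-map⁻ wordMat A∈
  ... | π , π∈ , refl = permutationMatrix-asm π (∈permutations⇒isPermutation π∈) ,
                        λ i j _ _ Aij≡-1 _ → ⊥-elim (wordMat-no-minus π i j Aij≡-1)

  ∈oneMinusMatrices⇒ : ∀ {A : Mat n n} → A ∈ oneMinusMatrices n → IsASM A × AtMostOneMinus A
  ∈oneMinusMatrices⇒ A∈ with ∈.∈-cartesianProductWith⁻ decodeCode (masks n 3 (n ∸ 3)) _ A∈
  ... | mr , (mc , π) , _ , code∈ , refl =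
    Decode.asm mr mc π (∈permutations⇒isPermutation (proj₂ (∈.∈-cartesianProduct⁻ (masks n 3 (n ∸ 3)) _ code∈))) ,
    Decode.atMostOneMinus mr mc π

  ∈atMostOneMinusASMs⇒ : ∀ {A : Mat n n} → A ∈ atMostOneMinusASMs n → IsASM A × AtMostOneMinus A
  ∈atMostOneMinusASMs⇒ A∈ with ∈.∈-++⁻ (permutationMatrices n) A∈
  ... | inj₁ A∈₁ = ∈permutationMatrices⇒ A∈₁
  ... | inj₂ A∈₂ = ∈oneMinusMatrices⇒ A∈₂

  ∈atMostOneMinusASMs⇐ : ∀ {A : Mat n n} → IsASM A → AtMostOneMinus A → A ∈ atMostOneMinusASMs n
  ∈atMostOneMinusASMs⇐ {A} asm at-most-one with Fin.any? (λ i → Fin.any? λ j → A ⟨ i , j ⟩ ℤ.≟ -1ℤ)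
  ... | no no-minus =
    ∈.∈-++⁺ˡ (subst (_∈ permutationMatrices n) (sym N.≡permutationMatrix)
               (∈.∈-map⁺ wordMat (injective⇒∈permutations N.π N.π-injective)))
    where module N = NoMinus A asm (λ i j Aij≡-1 → no-minus (i , j , Aij≡-1))
  ... | yes (i , j , Aij≡-1)
    with ASM.bump-column A asm Aij≡-1 (λ t Atj≡-1 → proj₁ (at-most-one t j i j Atj≡-1 Aij≡-1))
       | ASM.bump-row A asm Aij≡-1 (λ t Ait≡-1 → proj₂ (at-most-one i t i j Ait≡-1 Aij≡-1))
  ... | a , b , column-bump | c , d , row-bump
    with maskThrough (a ∷ i ∷ b ∷ []) (IsBumpAt.p<q column-bump ∷ IsBumpAt.q<r column-bump ∷ [-])
       | maskThrough (c ∷ j ∷ d ∷ []) (IsBumpAt.p<q row-bump ∷ IsBumpAt.q<r row-bump ∷ [-])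
  ... | mr , mr≗ | mc , mc≗ =
    ∈.∈-++⁺ʳ (permutationMatrices n) (subst (_∈ oneMinusMatrices n) (sym O.≡decode)
      (∈.∈-cartesianProductWith⁺ decodeCode (∈-masks mr)
        (∈.∈-cartesianProduct⁺ (∈-masks mc) (injective⇒∈permutations O.π O.π-injective))))
    where module O = OneMinus A asm at-most-one Aij≡-1 column-bump row-bump mr mc mr≗ mc≗

  atMostOneMinusASMs-unique : Unique (atMostOneMinusASMs n)
  atMostOneMinusASMs-unique =
    Unique.++⁺ (Unique.map⁺ wordMat-injective (permutations-unique n))
               (Unique.cartesianProductWith⁺ decodeCode decodeCode-injective (masks-unique n 3 (n ∸ 3))
                  (Unique.cartesianProduct⁺ (masks-unique n 3 (n ∸ 3)) (permutations-unique (n ∸ 3))))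
               disjoint
    where
    decodeCode-injective : ∀ {mr mr′ : Mask n 3 (n ∸ 3)} {code code′} →
                           decodeCode mr code ≡ decodeCode mr′ code′ → mr ≡ mr′ × code ≡ code′
    decodeCode-injective {mr} {mr′} {mc , π} {mc′ , π′} same with decode-injective {mr = mr} {mc} {mr′} {mc′} {π} {π′} same
    ... | refl , refl , refl = refl , refl
    disjoint : ∀ {A} → ¬ (A ∈ permutationMatrices n × A ∈ oneMinusMatrices n)
    disjoint (A∈₁ , A∈₂) with ∈.∈-map⁻ wordMat A∈₁ | ∈.∈-cartesianProductWith⁻ decodeCode (masks n 3 (n ∸ 3)) _ A∈₂
    ... | π , _ , refl | mr , (mc , π′) , _ , _ , same =
      wordMat-no-minus π (marked mr 1F) (marked mc 1F)
        (trans (cong (λ M → M ⟨ marked mr 1F , marked mc 1F ⟩) same) (Decode.entry-embed mr mc π′ (inj₁ 1F) (inj₁ 1F)))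

length-oneMinusMatrices : ∀ n → length (oneMinusMatrices n) ≡ (n C 3) * ((n C 3) * (n ∸ 3) !)
length-oneMinusMatrices 0 = refl
length-oneMinusMatrices 1 = refl
length-oneMinusMatrices 2 = refl
length-oneMinusMatrices (suc (suc (suc k))) =
  trans (length-cartesianProductWith decodeCode (masks (3 + k) 3 k) _)
    (cong₂ _*_ (length-masks (3 + k) 3 k refl)
      (trans (length-cartesianProductWith _,_ (masks (3 + k) 3 k) (permutations k))
        (cong₂ _*_ (length-masks (3 + k) 3 k refl) (length-permutations k))))

[3+k]!/6≡[3+k]C3*k! : ∀ k → (3 + k) ! / 6 ≡ ((3 + k) C 3) * k !
[3+k]!/6≡[3+k]C3*k! k with k![n∸k]!∣n! {3 + k} {3} (s≤s (s≤s (s≤s z≤n)))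
... | divides q [3+k]!≡q*6k! = begin
  (3 + k) ! / 6             ≡⟨ cong (_/ 6) [3+k]!≡q*6k! ⟩
  q * (6 * k !) / 6         ≡⟨ cong (λ m → q * m / 6) (ℕ.*-comm 6 (k !)) ⟩
  q * (k ! * 6) / 6         ≡⟨ cong (_/ 6) (ℕ.*-assoc q (k !) 6) ⟨
  q * k ! * 6 / 6           ≡⟨ m*n/n≡m (q * k !) 6 ⟩
  q * k !                   ≡⟨ cong (_* k !) C≡q ⟨
  ((3 + k) C 3) * k !         ∎
  where
  open ≡-Reasoning
  instance
    6k!≢0 : ℕ.NonZero (3 ! * k !)
    6k!≢0 = ℕ.m*n≢0 (3 !) (k !) {{ℕ._!≢0 3}} {{ℕ._!≢0 k}}
  C≡q : ((3 + k) C 3) ≡ q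
  C≡q = trans (nCk≡n!/k![n-k]! {3 + k} {3} (s≤s (s≤s (s≤s z≤n))))
              (trans (cong (_/ (3 ! * k !)) [3+k]!≡q*6k!) (m*n/n≡m q (3 ! * k !)))

count : ∀ n → n ! + (n C 3) * ((n C 3) * (n ∸ 3) !) ≡ n ! / 6 * (n C 3) + n !
count 0 = refl
count 1 = refl
count 2 = refl
count n@(suc (suc (suc k))) = begin
  n ! + (n C 3) * ((n C 3) * k !) ≡⟨ ℕ.+-comm (n !) _ ⟩
  (n C 3) * ((n C 3) * k !) + n ! ≡⟨ cong (_+ n !) (ℕ.*-comm (n C 3) ((n C 3) * k !)) ⟩
  (n C 3) * k ! * (n C 3) + n !   ≡⟨ cong (λ m → m * (n C 3) + n !) ([3+k]!/6≡[3+k]C3*k! k) ⟨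
  n ! / 6 * (n C 3) + n !       ∎
  where open ≡-Reasoning

length-atMostOneMinusASMs : ∀ n → length (atMostOneMinusASMs n) ≡ n ! / 6 * (n C 3) + n !
length-atMostOneMinusASMs n = begin
  length (permutationMatrices n ++ oneMinusMatrices n)
    ≡⟨ List.length-++ (permutationMatrices n) ⟩
  length (permutationMatrices n) + length (oneMinusMatrices n)
    ≡⟨ cong₂ _+_ (trans (List.length-map wordMat (permutations n)) (length-permutations n)) (length-oneMinusMatrices n) ⟩
  n ! + (n C 3) * ((n C 3) * (n ∸ 3) !)
    ≡⟨ count n ⟩
  n ! / 6 * (n C 3) + n ! ∎
  where open ≡-Reasoning

proposition6p2 : (∀ (n : ℕ) (A : Mat n n) → IsASM A →
    (AtMostOneMinus A ⇔ AvoidsAll A))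
    × (∀ (n : ℕ) → Σ (List (Mat n n)) λ xs →
    Unique xs × (∀ (A : Mat n n) → (A ∈ xs ⇔ (IsASM A × AtMostOneMinus A)))
    × length xs ≡ (n !) / 6 * (n C 3) + n !)
proposition6p2 =
  atMostOneMinus⇔avoidsAll ,
  λ n → atMostOneMinusASMs n ,
        atMostOneMinusASMs-unique ,
        (λ A → mk⇔ ∈atMostOneMinusASMs⇒ λ (asm , at-most-one) → ∈atMostOneMinusASMs⇐ asm at-most-one) ,
        length-atMostOneMinusASMs n
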